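{- Let $G$ be a multigraph without loops and $f:V(G)\to\mathbb{N}$. Suppose there are a subgraph $F\subseteq G$ and a set $Y\subseteq V(G)$ such that: (1) any multiple edges of $G$ are contained in $G[Y]$; (2) $f(v)\ge d_G(v)$ for all $v\in V(G)-Y$; (3) $f(v)\ge d_{G[Y]}(v)+d_F(v)+1$ for all $v\in Y$; (4) for each component $T$ of $G-Y$ there are distinct $x_1,x_2\in V(T)$ with $N_T[x_1]=N_T[x_2]$ and $T-\{x_1,x_2\}$ connected, such that either (a) there are edges $x_1y_1,x_2y_2\in E(F)$ with $y_1\ne y_2$ and $N(x_i)\cap Y=\{y_i\}$ for $i\in\{1,2\}$; or (b) $|N(x_2)\cap Y|=0$ and there is an edge $x_1y_1\in E(F)$ with $N(x_1)\cap Y=\{y_1\}$. Then $G$ is $f$-AT.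
   Context: $N_T[x]$ is the closed neighborhood of $x$ in $T$; $N(x)$ is the neighborhood in $G$. For a directed multigraph $D$, a subgraph $H$ is Eulerian if $d^-_H(v)=d^+_H(v)$ for all $v\in V(H)$; $EE(D)$ (resp. $EO(D)$) counts spanning Eulerian subgraphs with an even (resp. odd) number of edges. $G$ is $f$-AT if it has an orientation $D$ with $f(v)\ge d^+_D(v)+1$ for all $v$ and $EE(D)\ne EO(D)$. -}

module Defs where

open import Data.Nat using (ℕ; zero; suc; _+_; _≤_; _%_)
open import Data.Nat.Properties using () renaming (_≟_ to _≟ℕ_)
open import Data.Bool using (Bool; true; false; if_then_else_)
open import Data.Fin using (Fin; zero; suc)
open import Data.Fin.Properties using (_≟_; all?)
open import Data.Fin.Subset using (Subset; _∈_; _∉_; ∣_∣; inside; outside)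
open import Data.Fin.Subset.Properties using (_∈?_)
open import Data.Vec using (Vec; []; _∷_)
open import Data.List using (List; []; _∷_; map; _++_; length; filter)
open import Data.Product using (Σ; ∃; _×_; _,_; proj₁; proj₂)
open import Data.Sum using (_⊎_)
open import Relation.Nullary using (¬_; Dec; does; yes; no)
open import Relation.Nullary.Decidable using (_×-dec_; _⊎-dec_)
open import Relation.Binary.PropositionalEquality using (_≡_; _≢_)
open import Function.Bundles using (_⇔_)

-- Vertices are Fin n, edges are Fin m (edges are labelled, so parallel
-- edges are allowed); each edge has an ordered pair of endpoints (the
-- order is only a reference orientation; the graph is undirected), and
-- the two endpoints are distinct (no loops).

record Multigraph : Set where
  field
    n        : ℕ
    m        : ℕ
    end₁     : Fin m → Fin n
    end₂     : Fin m → Fin n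
    loopless : ∀ e → end₁ e ≢ end₂ e

module _ (G : Multigraph) where
  open Multigraph G

  countFin : ∀ {k} {P : Fin k → Set} → (∀ i → Dec (P i)) → ℕ
  countFin {zero}  P? = 0
  countFin {suc k} P? =
    (if does (P? zero) then 1 else 0) + countFin (λ i → P? (suc i))

  Inc : Fin m → Fin n → Set
  Inc e v = (end₁ e ≡ v) ⊎ (end₂ e ≡ v)

  inc? : ∀ e v → Dec (Inc e v)
  inc? e v = (end₁ e ≟ v) ⊎-dec (end₂ e ≟ v)

  Joins : Fin m → Fin n → Fin n → Set
  Joins e u w = ((end₁ e ≡ u) × (end₂ e ≡ w)) ⊎ ((end₁ e ≡ w) × (end₂ e ≡ u))

  Adj : Fin n → Fin n → Set
  Adj u w = ∃ λ e → Joins e u w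

  -- degree in G (loopless, so every incident edge counts once)
  deg : Fin n → ℕ
  deg v = countFin (λ e → inc? e v)

  degInduced : Subset n → Fin n → ℕ
  degInduced Y v =
    countFin (λ e → inc? e v ×-dec (end₁ e ∈? Y ×-dec end₂ e ∈? Y))

  degSub : Subset m → Fin n → ℕ
  degSub F v = countFin (λ e → (e ∈? F) ×-dec inc? e v)

  -- Orientations: D e = true orients e from end₁ to end₂,
  -- D e = false orients e from end₂ to end₁.
  Orientation : Set
  Orientation = Fin m → Bool

  tail : Orientation → Fin m → Fin n
  tail D e = if D e then end₁ e else end₂ e

  head : Orientation → Fin m → Fin n
  head D e = if D e then end₂ e else end₁ e

  outdeg : Orientation → Fin n → ℕ
  outdeg D v = countFin (λ e → tail D e ≟ v)

  outdegSub : Orientation → Subset m → Fin n → ℕ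
  outdegSub D H v = countFin (λ e → (e ∈? H) ×-dec (tail D e ≟ v))

  indegSub : Orientation → Subset m → Fin n → ℕ
  indegSub D H v = countFin (λ e → (e ∈? H) ×-dec (head D e ≟ v))

  Eulerian : Orientation → Subset m → Set
  Eulerian D H = ∀ v → indegSub D H v ≡ outdegSub D H v

  eulerian? : ∀ D H → Dec (Eulerian D H)
  eulerian? D H = all? (λ v → indegSub D H v ≟ℕ outdegSub D H v)

allSubsets : ∀ k → List (Subset k)
allSubsets zero    = [] ∷ []
allSubsets (suc k) =
  map (inside ∷_) (allSubsets k) ++ map (outside ∷_) (allSubsets k)

module _ (G : Multigraph) where
  open Multigraph G

  EE : Orientation G → ℕ
  EE D = length (filter (λ H → eulerian? G D H ×-dec (∣ H ∣ % 2 ≟ℕ 0))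
                        (allSubsets m))

  EO : Orientation G → ℕ
  EO D = length (filter (λ H → eulerian? G D H ×-dec (∣ H ∣ % 2 ≟ℕ 1))
                        (allSubsets m))

  _-AT : (Fin n → ℕ) → Set
  _-AT f = ∃ λ (D : Orientation G) →
             (∀ v → suc (outdeg G D v) ≤ f v) × (EE D ≢ EO D)

  data Walk (S : Fin n → Set) : Fin n → Fin n → Set where
    here : ∀ {u} → S u → Walk S u u
    step : ∀ {u w v} → S u → Adj G u w → Walk S w v → Walk S u v

  -- vertex set of the component of G - Y containing v (for v ∉ Y)
  InComp : Subset n → Fin n → Fin n → Set
  InComp Y v w = Walk (λ z → z ∉ Y) v w

  Connected : (Fin n → Set) → Set
  Connected S = ∀ u w → S u → S w → Walk S u w

  InClosedNbhd : (Fin n → Set) → Fin n → Fin n → Set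
  InClosedNbhd S x w = S w × ((w ≡ x) ⊎ Adj G x w)

  NbhdInYIs : Subset n → Fin n → Fin n → Set
  NbhdInYIs Y x y = ∀ w → ((w ∈ Y) × Adj G x w) ⇔ (w ≡ y)

  NoNbrInY : Subset n → Fin n → Set
  NoNbrInY Y x = ∀ w → w ∈ Y → ¬ Adj G x w

  EdgeIn : Subset m → Fin n → Fin n → Set
  EdgeIn F x y = ∃ λ e → (e ∈ F) × Joins G e x y

  Hyp1 : Subset n → Set
  Hyp1 Y = ∀ e e' → e ≢ e' → Joins G e' (end₁ e) (end₂ e) →
           (end₁ e ∈ Y) × (end₂ e ∈ Y)

  Hyp2 : (Fin n → ℕ) → Subset n → Set
  Hyp2 f Y = ∀ v → v ∉ Y → deg G v ≤ f v

  Hyp3 : (Fin n → ℕ) → Subset m → Subset n → Set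
  Hyp3 f F Y = ∀ v → v ∈ Y → suc (degInduced G Y v + degSub G F v) ≤ f v

  Hyp4Comp : Subset m → Subset n → (Fin n → Set) → Set
  Hyp4Comp F Y T =
    ∃ λ x₁ → ∃ λ x₂ →
      x₁ ≢ x₂ × T x₁ × T x₂ ×
      (∀ w → InClosedNbhd T x₁ w ⇔ InClosedNbhd T x₂ w) ×
      Connected (λ z → T z × z ≢ x₁ × z ≢ x₂) ×
      ( (∃ λ y₁ → ∃ λ y₂ →
           EdgeIn F x₁ y₁ × EdgeIn F x₂ y₂ × y₁ ≢ y₂ ×
           NbhdInYIs Y x₁ y₁ × NbhdInYIs Y x₂ y₂)
      ⊎ (NoNbrInY Y x₂ ×
         (∃ λ y₁ → EdgeIn F x₁ y₁ × NbhdInYIs Y x₁ y₁)))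

  -- (4) for every component of G - Y (each component is the component
  -- of some vertex v ∉ Y)
  Hyp4 : Subset m → Subset n → Set
  Hyp4 F Y = ∀ v → v ∉ Y → Hyp4Comp F Y (InComp Y v)

module Submission where

-- For each component T of G - Y take x₁, x₂, y₁ (and y₂) from (4),
-- named so that y₂ has the smaller index in case (a).  Orient G by a rank in
-- which Y lies below G - Y and, inside T, x₁ is highest, x₂ next and the other
-- vertices follow by increasing distance from x₁; only the entrance edge
-- x₁y₁ ∈ F is reversed to y₁ → x₁.  Then every vertex of G - Y has an in-arc,
-- and the arcs leaving Y are edges of G[Y] or of F, so (2) and (3) give
-- d⁺(v) < f(v).
--
-- For EE ≠ EO consider an arc a = x₁ → w with w ∈ T - x₂ and its detour
-- x₁ → x₂ → w (x₂ is a twin of x₁).  If an Eulerian subgraph uses exactly a or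
-- exactly the detour, exchanging them ("switching") keeps it Eulerian and
-- changes its size by one.  Since x₁ and x₂ have in-degree at most one, each
-- component carries at most one switchable arc, so switching at the first
-- switchable arc is an involution.  A nonempty Eulerian subgraph without
-- switchable arc cannot exist: all its arcs would decrease an explicit
-- potential.  Hence the involution pairs odd Eulerian subgraphs with nonempty
-- even ones, and EE(D) = EO(D) + 1.

open import Defs
open import Data.Nat using (ℕ; zero; suc; _+_; _*_; _∸_; _≤_; _<_; z≤n; s≤s)
open import Data.Nat.Properties hiding (_≟_)
open import Data.Nat.Properties using () renaming (_≟_ to _≟ℕ_)
open import Data.Nat.DivMod using (_%_; [m+n]%n≡m%n)
open import Data.Nat.Tactic.RingSolver using (solve-∀)
open import Data.Bool using (Bool; true; false; not; _∧_; _∨_; if_then_else_)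
open import Data.Bool.Properties using (∧-zeroʳ; ∧-identityʳ; not-involutive)
open import Data.Fin using (Fin; zero; suc; toℕ; fromℕ<)
open import Data.Fin.Properties using (_≟_; any?; toℕ-injective; toℕ-fromℕ<; toℕ<n)
open import Data.Fin.Subset using (Subset; _∈_; _∉_; inside; outside; ∣_∣)
open import Data.Fin.Subset.Properties using (_∈?_)
open import Data.Vec using ([]; _∷_; lookup; tabulate; replicate)
open import Data.Vec.Properties using (lookup∘tabulate; tabulate∘lookup; tabulate-cong; lookup-replicate)
open import Data.List using (List; []; _∷_; map; filter; length)
open import Data.List.Properties using (length-map)
open import Data.List.Relation.Unary.All using (All; []; _∷_)
import Data.List.Relation.Unary.All as All
open import Data.List.Relation.Unary.Any using (here)
open import Data.List.Relation.Unary.Unique.Propositional using (Unique)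
open import Data.List.Relation.Unary.AllPairs using ([]; _∷_)
import Data.List.Relation.Unary.Unique.Propositional.Properties as Unique
open import Data.List.Membership.Propositional using () renaming (_∈_ to _∈ₗ_)
open import Data.List.Membership.Propositional.Properties using (∈-filter⁺; ∈-filter⁻; ∈-map⁺; ∈-map⁻; ∈-++⁺ˡ; ∈-++⁺ʳ)
open import Data.List.Membership.Propositional.Properties.WithK using (unique∧set⇒bag)
open import Data.List.Relation.Binary.BagAndSetEquality using (∼bag⇒↭)
open import Data.List.Relation.Binary.Permutation.Propositional.Properties using (↭-length)
open import Data.Product using (Σ; ∃; _×_; _,_; proj₁; proj₂)
open import Data.Sum using (_⊎_; inj₁; inj₂)
open import Data.Empty using (⊥; ⊥-elim)
open import Data.Maybe using (Maybe; just; nothing)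
import Data.Maybe as Maybe
open import Function using (_∘_)
open import Function.Bundles using (_⇔_; mk⇔; Equivalence)
open import Function.Construct.Symmetry using (⇔-sym)
open import Relation.Nullary using (¬_; Dec; does; yes; no)
open import Relation.Nullary.Decidable using (_×-dec_; _⊎-dec_; ¬?; map′; dec-true; dec-false; does-⇔)
open import Relation.Unary using (Decidable)
open import Relation.Binary.Definitions using (tri<; tri≈; tri>)
open import Relation.Binary.PropositionalEquality

dec-sound : ∀ {A : Set} (a? : Dec A) → does a? ≡ true → A
dec-sound (yes a) _ = a

bool? : (b : Bool) → Dec (b ≡ true)
bool? true  = yes refl
bool? false = no λ ()

not-true : (b : Bool) → ¬ (b ≡ true) → b ≡ false
not-true true  b≢t = ⊥-elim (b≢t refl)
not-true false _   = refl

true≢false : true ≢ false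
true≢false ()

∧-proj₁ : ∀ {a b} → a ∧ b ≡ true → a ≡ true
∧-proj₁ {true} _ = refl

∧-proj₂ : ∀ {a b} → a ∧ b ≡ true → b ≡ true
∧-proj₂ {true} p = p

∧-intro : ∀ {a b} → a ≡ true → b ≡ true → a ∧ b ≡ true
∧-intro refl refl = refl

cong₃ : ∀ {A B C D : Set} (g : A → B → C → D) {a a' b b' c c'} →
        a ≡ a' → b ≡ b' → c ≡ c' → g a b c ≡ g a' b' c'
cong₃ g refl refl refl = refl

ind : Bool → ℕ
ind true  = 1
ind false = 0

count : ∀ {k} → (Fin k → Bool) → ℕ
count {zero}  b = 0
count {suc k} b = ind (b zero) + count (b ∘ suc)

count-ext : ∀ {k} (b c : Fin k → Bool) → (∀ i → b i ≡ c i) → count b ≡ count c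
count-ext {zero}  b c b≗c = refl
count-ext {suc k} b c b≗c = cong₂ _+_ (cong ind (b≗c zero)) (count-ext _ _ (b≗c ∘ suc))

countFin≡count : ∀ (G : Multigraph) {k} {P : Fin k → Set} (P? : ∀ i → Dec (P i)) →
                 countFin G P? ≡ count (λ i → does (P? i))
countFin≡count G {zero}  P? = refl
countFin≡count G {suc k} P? = cong₂ _+_ (ind-if (does (P? zero))) (countFin≡count G (P? ∘ suc))
  where
  ind-if : ∀ b → (if b then 1 else 0) ≡ ind b
  ind-if true  = refl
  ind-if false = refl

count-≤ : ∀ {k} (b : Fin k → Bool) → count b ≤ k
count-≤ {zero}  b = z≤n
count-≤ {suc k} b with b zero
... | true  = s≤s (count-≤ _)
... | false = m≤n⇒m≤1+n (count-≤ _)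

ind-mono : ∀ {x y} → (x ≡ true → y ≡ true) → ind x ≤ ind y
ind-mono {false} x⇒y = z≤n
ind-mono {true}  x⇒y rewrite x⇒y refl = ≤-refl

count-mono : ∀ {k} (b c : Fin k → Bool) → (∀ i → b i ≡ true → c i ≡ true) → count b ≤ count c
count-mono {zero}  b c b⊆c = z≤n
count-mono {suc k} b c b⊆c = +-mono-≤ (ind-mono (b⊆c zero)) (count-mono _ _ (b⊆c ∘ suc))

count-strict : ∀ {k} (b c : Fin k → Bool) → (∀ i → b i ≡ true → c i ≡ true) →
               (j : Fin k) → c j ≡ true → b j ≡ false → suc (count b) ≤ count c
count-strict {suc k} b c b⊆c zero cj bj rewrite cj | bj = s≤s (count-mono _ _ (b⊆c ∘ suc))
count-strict {suc k} b c b⊆c (suc j) cj bj =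
  ≤-trans (≤-reflexive (sym (+-suc (ind (b zero)) _)))
          (+-mono-≤ (ind-mono (b⊆c zero)) (count-strict _ _ (b⊆c ∘ suc) j cj bj))

count-∪ : ∀ {k} (b c d : Fin k → Bool) → (∀ i → b i ≡ true → (c i ≡ true) ⊎ (d i ≡ true)) →
          count b ≤ count c + count d
count-∪ {zero}  b c d b⊆c∪d = z≤n
count-∪ {suc k} b c d b⊆c∪d =
  ≤-trans (+-mono-≤ (ind-∪ (b⊆c∪d zero)) (count-∪ _ _ _ (b⊆c∪d ∘ suc)))
          (≤-reflexive (interchange (ind (c zero)) (ind (d zero)) _ _))
  where
  ind-∪ : ∀ {x y z} → (x ≡ true → (y ≡ true) ⊎ (z ≡ true)) → ind x ≤ ind y + ind z
  ind-∪ {false} _ = z≤n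
  ind-∪ {true} {y} x⇒y∨z with x⇒y∨z refl
  ... | inj₁ refl = s≤s z≤n
  ... | inj₂ refl = m≤n+m 1 (ind y)
  interchange : ∀ a b p q → a + b + (p + q) ≡ (a + p) + (b + q)
  interchange = solve-∀

count-zero : ∀ {k} (b : Fin k → Bool) → (∀ i → b i ≡ false) → count b ≡ 0
count-zero {zero}  b b≗false = refl
count-zero {suc k} b b≗false rewrite b≗false zero = count-zero _ (b≗false ∘ suc)

count-pos : ∀ {k} (b : Fin k → Bool) (j : Fin k) → b j ≡ true → 1 ≤ count b
count-pos b zero    bj rewrite bj = s≤s z≤n
count-pos b (suc j) bj = ≤-trans (count-pos (b ∘ suc) j bj) (m≤n+m _ (ind (b zero)))

count-witness : ∀ {k} (b : Fin k → Bool) → 1 ≤ count b → ∃ λ i → b i ≡ true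
count-witness {suc k} b pos with b zero in bz
... | true  = zero , bz
... | false = let (i , bi) = count-witness (b ∘ suc) pos in suc i , bi

count-≤1 : ∀ {k} (b : Fin k → Bool) (j : Fin k) → (∀ i → b i ≡ true → i ≡ j) → count b ≤ 1
count-≤1 b j only-j =
  ≤-trans (count-mono b (λ i → does (i ≟ j)) (λ i bi → dec-true (i ≟ j) (only-j i bi)))
          (≤-reflexive (single j))
  where
  single : ∀ {k} (j : Fin k) → count (λ i → does (i ≟ j)) ≡ 1
  single {suc k} zero    = cong suc (count-zero {k} _ (λ i → refl))
  single {suc k} (suc j) = single j

count-≥2 : ∀ {k} (b : Fin k → Bool) (i j : Fin k) → b i ≡ true → b j ≡ true → i ≢ j → 2 ≤ count b
count-≥2 {k} b i j bi bj i≢j =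
  ≤-trans (s≤s (count-pos single-i i (dec-true (i ≟ i) refl)))
          (count-strict single-i b single-i⊆b j bj (dec-false (j ≟ i) (i≢j ∘ sym)))
  where
  single-i : Fin k → Bool
  single-i x = does (x ≟ i)
  single-i⊆b : ∀ x → single-i x ≡ true → b x ≡ true
  single-i⊆b x p rewrite dec-sound (x ≟ i) p = bi

upd : ∀ {k} → (Fin k → Bool) → Fin k → Bool → Fin k → Bool
upd b j x i = if does (i ≟ j) then x else b i

upd-same : ∀ {k} (b : Fin k → Bool) i x → upd b i x i ≡ x
upd-same b i x rewrite dec-true (i ≟ i) refl = refl

upd-other : ∀ {k} (b : Fin k → Bool) i x e → e ≢ i → upd b i x e ≡ b e
upd-other b i x e e≢i rewrite dec-false (e ≟ i) e≢i = refl

upd-cong : ∀ {k} {b b' : Fin k → Bool} i {x x'} → x ≡ x' → (∀ e → b e ≡ b' e) →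
           ∀ e → upd b i x e ≡ upd b' i x' e
upd-cong i refl b≗b' e with e ≟ i
... | yes _ = refl
... | no _  = b≗b' e

count-upd : ∀ {k} (b : Fin k → Bool) (j : Fin k) (x : Bool) →
            count (upd b j x) + ind (b j) ≡ count b + ind x
count-upd {suc k} b zero x =
  begin
    ind x + count (b ∘ suc) + ind (b zero) ≡⟨ swap (ind x) _ _ ⟩
    ind (b zero) + count (b ∘ suc) + ind x ∎
  where
  open ≡-Reasoning
  swap : ∀ p q r → p + q + r ≡ r + q + p
  swap = solve-∀
count-upd {suc k} b (suc j) x =
  begin
    ind (b zero) + count (λ i → upd b (suc j) x (suc i)) + ind (b (suc j))
      ≡⟨ cong (λ z → ind (b zero) + z + ind (b (suc j))) (count-ext _ _ shift) ⟩
    ind (b zero) + count (upd (b ∘ suc) j x) + ind (b (suc j))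
      ≡⟨ +-assoc (ind (b zero)) _ _ ⟩
    ind (b zero) + (count (upd (b ∘ suc) j x) + ind (b (suc j)))
      ≡⟨ cong (ind (b zero) +_) (count-upd (b ∘ suc) j x) ⟩
    ind (b zero) + (count (b ∘ suc) + ind x)
      ≡⟨ sym (+-assoc (ind (b zero)) _ _) ⟩
    ind (b zero) + count (b ∘ suc) + ind x ∎
  where
  open ≡-Reasoning
  shift : ∀ i → upd b (suc j) x (suc i) ≡ upd (b ∘ suc) j x i
  shift i with i ≟ j
  ... | yes _ = refl
  ... | no _  = refl

count-upd₃ : ∀ {k} (g : Fin k → Bool) a b c x y z → a ≢ b → a ≢ c → b ≢ c →
             count (upd (upd (upd g a x) b y) c z) + (ind (g a) + ind (g b) + ind (g c))
             ≡ count g + (ind x + ind y + ind z)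
count-upd₃ {k} g a b c x y z a≢b a≢c b≢c =
  begin
    count (upd g₂ c z) + (ind (g a) + ind (g b) + ind (g c))
      ≡⟨ cong (λ q → count (upd g₂ c z) + (ind (g a) + ind (g b) + ind q)) (sym g₂c) ⟩
    count (upd g₂ c z) + (ind (g a) + ind (g b) + ind (g₂ c))
      ≡⟨ r₁ (count (upd g₂ c z)) (ind (g a)) (ind (g b)) (ind (g₂ c)) ⟩
    (count (upd g₂ c z) + ind (g₂ c)) + ind (g a) + ind (g b)
      ≡⟨ cong (λ q → q + ind (g a) + ind (g b)) (count-upd g₂ c z) ⟩
    (count g₂ + ind z) + ind (g a) + ind (g b)
      ≡⟨ cong (λ q → (count g₂ + ind z) + ind (g a) + ind q) (sym g₁b) ⟩
    (count g₂ + ind z) + ind (g a) + ind (g₁ b)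
      ≡⟨ r₂ (count g₂) (ind z) (ind (g a)) (ind (g₁ b)) ⟩
    (count g₂ + ind (g₁ b)) + ind (g a) + ind z
      ≡⟨ cong (λ q → q + ind (g a) + ind z) (count-upd g₁ b y) ⟩
    (count g₁ + ind y) + ind (g a) + ind z
      ≡⟨ r₃ (count g₁) (ind y) (ind (g a)) (ind z) ⟩
    (count g₁ + ind (g a)) + ind y + ind z
      ≡⟨ cong (λ q → q + ind y + ind z) (count-upd g a x) ⟩
    (count g + ind x) + ind y + ind z
      ≡⟨ r₄ (count g) (ind x) (ind y) (ind z) ⟩
    count g + (ind x + ind y + ind z) ∎
  where
  open ≡-Reasoning
  g₁ g₂ : Fin k → Bool
  g₁ = upd g a x
  g₂ = upd g₁ b y
  g₁b : g₁ b ≡ g b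
  g₁b = upd-other g a x b (a≢b ∘ sym)
  g₂c : g₂ c ≡ g c
  g₂c = trans (upd-other g₁ b y c (b≢c ∘ sym)) (upd-other g a x c (a≢c ∘ sym))
  r₁ : ∀ p q r s → p + (q + r + s) ≡ (p + s) + q + r
  r₁ = solve-∀
  r₂ : ∀ p q r s → (p + q) + r + s ≡ (p + s) + r + q
  r₂ = solve-∀
  r₃ : ∀ p q r s → (p + q) + r + s ≡ (p + r) + q + s
  r₃ = solve-∀
  r₄ : ∀ p q r s → (p + q) + r + s ≡ p + (q + r + s)
  r₄ = solve-∀

first : ∀ {k} → (Fin k → Bool) → Maybe (Fin k)
first {zero}  b = nothing
first {suc k} b with b zero
... | true  = just zero
... | false = Maybe.map suc (first (b ∘ suc))

first-cases : ∀ {k} (b : Fin k → Bool) → (first b ≡ nothing) ⊎ (∃ λ i → first b ≡ just i)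
first-cases b with first b
... | nothing = inj₁ refl
... | just i  = inj₂ (i , refl)

first-just : ∀ {k} (b : Fin k → Bool) {i} → first b ≡ just i → b i ≡ true
first-just {suc k} b {i} eq with b zero in bz
first-just {suc k} b {zero} refl | true = bz
first-just {suc k} b {i} eq | false with first (b ∘ suc) in e
first-just {suc k} b {suc i} refl | false | just j = first-just (b ∘ suc) e

first-nothing : ∀ {k} (b : Fin k → Bool) → first b ≡ nothing → ∀ i → b i ≡ false
first-nothing {suc k} b eq i with b zero in bz
first-nothing {suc k} b () i | true
first-nothing {suc k} b eq i | false with first (b ∘ suc) in e
first-nothing {suc k} b refl zero    | false | nothing = bz
first-nothing {suc k} b refl (suc i) | false | nothing = first-nothing (b ∘ suc) e i

first-min : ∀ {k} (b : Fin k → Bool) {i} j → first b ≡ just i → b j ≡ true → toℕ i ≤ toℕ j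
first-min {suc k} b j eq bj with b zero in bz
first-min {suc k} b j refl bj | true = z≤n
first-min {suc k} b zero eq bj | false with trans (sym bz) bj
... | ()
first-min {suc k} b (suc j) eq bj | false with first (b ∘ suc) in e
first-min {suc k} b (suc j) refl bj | false | just i = s≤s (first-min (b ∘ suc) j e bj)

first-total : ∀ {k} (b : Fin k → Bool) j → b j ≡ true → ∃ λ i → first b ≡ just i
first-total b j bj with first b in e
... | just i  = i , refl
... | nothing with trans (sym (first-nothing b e j)) bj
...   | ()

first-ext : ∀ {k} (b c : Fin k → Bool) → (∀ i → b i ≡ c i) → first b ≡ first c
first-ext {zero}  b c b≗c = refl
first-ext {suc k} b c b≗c with b zero | c zero | b≗c zero
... | true  | true  | refl = refl
... | false | false | refl = cong (Maybe.map suc) (first-ext _ _ (b≗c ∘ suc))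

first-char : ∀ {k} (b : Fin k → Bool) a → b a ≡ true → (∀ j → toℕ j < toℕ a → b j ≡ false) →
             first b ≡ just a
first-char b a ba before-a with first-total b a ba
... | i , e with <-cmp (toℕ i) (toℕ a)
... | tri< i<a _ _ with trans (sym (first-just b e)) (before-a i i<a)
...   | ()
first-char b a ba before-a | i , e | tri≈ _ i≡a _ = trans e (cong just (toℕ-injective i≡a))
first-char b a ba before-a | i , e | tri> _ _ i>a = ⊥-elim (<⇒≱ i>a (first-min b a e ba))

%2-suc-suc : ∀ x → suc (suc x) % 2 ≡ x % 2
%2-suc-suc x = trans (cong (_% 2) (+-comm 2 x)) ([m+n]%n≡m%n x 2)

parity-suc : ∀ x → (x % 2 ≡ 0 × suc x % 2 ≡ 1) ⊎ (x % 2 ≡ 1 × suc x % 2 ≡ 0)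
parity-suc zero = inj₁ (refl , refl)
parity-suc (suc x) with parity-suc x
... | inj₁ (x-even , x+1-odd) = inj₂ (x+1-odd , trans (%2-suc-suc x) x-even)
... | inj₂ (x-odd , x+1-even) = inj₁ (x+1-even , trans (%2-suc-suc x) x-odd)

OffByOne : ℕ → ℕ → Set
OffByOne x y = (y ≡ suc x) ⊎ (x ≡ suc y)

odd→even : ∀ {x y} → OffByOne x y → x % 2 ≡ 1 → y % 2 ≡ 0
odd→even {x} (inj₁ refl) odd with parity-suc x
... | inj₁ (even , _) = ⊥-elim (0≢1+n (trans (sym even) odd))
... | inj₂ (_ , y-even) = y-even
odd→even {y = y} (inj₂ refl) odd with parity-suc y
... | inj₁ (y-even , _) = y-even
... | inj₂ (_ , even) = ⊥-elim (0≢1+n (trans (sym even) odd))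

even→odd : ∀ {x y} → OffByOne x y → x % 2 ≡ 0 → y % 2 ≡ 1
even→odd {x} (inj₁ refl) even with parity-suc x
... | inj₁ (_ , y-odd) = y-odd
... | inj₂ (odd , _) = ⊥-elim (0≢1+n (trans (sym even) odd))
even→odd {y = y} (inj₂ refl) even with parity-suc y
... | inj₁ (_ , odd) = ⊥-elim (0≢1+n (trans (sym even) odd))
... | inj₂ (y-odd , _) = y-odd

toggle3 : ∀ {k} → (Fin k → Bool) → Fin k → Fin k → Fin k → Fin k → Bool
toggle3 h a b c = upd (upd (upd h a (not (h a))) b (not (h b))) c (not (h c))

module Toggle3 {k} (h : Fin k → Bool) (a b c : Fin k) (a≢b : a ≢ b) (a≢c : a ≢ c) (b≢c : b ≢ c) where

  private
    h₁ h₂ : Fin k → Bool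
    h₁ = upd h a (not (h a))
    h₂ = upd h₁ b (not (h b))

  at-a : toggle3 h a b c a ≡ not (h a)
  at-a = trans (upd-other h₂ c _ a a≢c) (trans (upd-other h₁ b _ a a≢b) (upd-same h a _))

  at-b : toggle3 h a b c b ≡ not (h b)
  at-b = trans (upd-other h₂ c _ b b≢c) (upd-same h₁ b _)

  at-c : toggle3 h a b c c ≡ not (h c)
  at-c = upd-same h₂ c _

  elsewhere : ∀ x → x ≢ a → x ≢ b → x ≢ c → toggle3 h a b c x ≡ h x
  elsewhere x x≢a x≢b x≢c =
    trans (upd-other h₂ c _ x x≢c) (trans (upd-other h₁ b _ x x≢b) (upd-other h a _ x x≢a))

  count-toggle3 : (R : Fin k → Bool) →
    count (λ e → toggle3 h a b c e ∧ R e) + (ind (h a ∧ R a) + ind (h b ∧ R b) + ind (h c ∧ R c))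
    ≡ count (λ e → h e ∧ R e) + (ind (not (h a) ∧ R a) + ind (not (h b) ∧ R b) + ind (not (h c) ∧ R c))
  count-toggle3 R =
    trans (cong (_+ (ind (g a) + ind (g b) + ind (g c))) (count-ext _ _ restrict))
          (count-upd₃ g a b c x y z a≢b a≢c b≢c)
    where
    g : Fin k → Bool
    g e = h e ∧ R e
    x y z : Bool
    x = not (h a) ∧ R a
    y = not (h b) ∧ R b
    z = not (h c) ∧ R c
    upd-∧ : ∀ (u : Fin k → Bool) i v e → (upd u i v e ∧ R e) ≡ upd (λ e → u e ∧ R e) i (v ∧ R i) e
    upd-∧ u i v e with e ≟ i
    ... | yes refl = refl
    ... | no _ = refl
    restrict : ∀ e → (toggle3 h a b c e ∧ R e) ≡ upd (upd (upd g a x) b y) c z e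
    restrict e = trans (upd-∧ (upd h₁ b (not (h b))) c (not (h c)) e)
                   (upd-cong c refl (λ e' → trans (upd-∧ h₁ b (not (h b)) e')
                                              (upd-cong b refl (upd-∧ h a (not (h a))) e')) e)

toggle3-involutive : ∀ {k} (h : Fin k → Bool) a b c → a ≢ b → a ≢ c → b ≢ c →
                     ∀ x → toggle3 (toggle3 h a b c) a b c x ≡ h x
toggle3-involutive h a b c a≢b a≢c b≢c x = by-position (x ≟ a) (x ≟ b) (x ≟ c)
  where
  module O = Toggle3 h a b c a≢b a≢c b≢c
  module I = Toggle3 (toggle3 h a b c) a b c a≢b a≢c b≢c
  by-position : Dec (x ≡ a) → Dec (x ≡ b) → Dec (x ≡ c) → toggle3 (toggle3 h a b c) a b c x ≡ h x
  by-position (yes refl) _ _ = trans I.at-a (trans (cong not O.at-a) (not-involutive (h x)))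
  by-position (no _) (yes refl) _ = trans I.at-b (trans (cong not O.at-b) (not-involutive (h x)))
  by-position (no _) (no _) (yes refl) = trans I.at-c (trans (cong not O.at-c) (not-involutive (h x)))
  by-position (no x≢a) (no x≢b) (no x≢c) = trans (I.elsewhere x x≢a x≢b x≢c) (O.elsewhere x x≢a x≢b x≢c)

toggle3-cong : ∀ {k} {h h' : Fin k → Bool} a b c → (∀ e → h e ≡ h' e) →
               ∀ x → toggle3 h a b c x ≡ toggle3 h' a b c x
toggle3-cong a b c h≗h' =
  upd-cong c (cong not (h≗h' c)) (upd-cong b (cong not (h≗h' b)) (upd-cong a (cong not (h≗h' a)) h≗h'))

-- Switching an arc a against a detour b, c.  The configuration is
-- switchable when exactly a is used, or exactly the detour is used.

Switchable : Bool → Bool → Bool → Set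
Switchable x y z = (x ≡ true × y ≡ false × z ≡ false) ⊎ (x ≡ false × y ≡ true × z ≡ true)

switchable : Bool → Bool → Bool → Bool
switchable x y z = (x ∧ not y ∧ not z) ∨ (not x ∧ y ∧ z)

switchable-sound : ∀ x y z → switchable x y z ≡ true → Switchable x y z
switchable-sound true  false false _ = inj₁ (refl , refl , refl)
switchable-sound false true  true  _ = inj₂ (refl , refl , refl)
switchable-sound true  true  _     ()
switchable-sound true  false true  ()
switchable-sound false false _     ()
switchable-sound false true  false ()

switchable-complete : ∀ {x y z} → Switchable x y z → switchable x y z ≡ true
switchable-complete (inj₁ (refl , refl , refl)) = refl
switchable-complete (inj₂ (refl , refl , refl)) = refl

switchable-not : ∀ {x y z} → Switchable x y z → Switchable (not x) (not y) (not z)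
switchable-not (inj₁ (refl , refl , refl)) = inj₂ (refl , refl , refl)
switchable-not (inj₂ (refl , refl , refl)) = inj₁ (refl , refl , refl)

unswitchable-arc : ∀ y z → switchable true y z ≡ false → (y ≡ true) ⊎ (y ≡ false × z ≡ true)
unswitchable-arc true  z     _ = inj₁ refl
unswitchable-arc false true  _ = inj₂ (refl , refl)

unswitchable-detour : ∀ x → switchable x true true ≡ false → x ≡ true
unswitchable-detour true _ = refl

-- Switching preserves the balance of a vertex.  Here ha, hb, hc (ta, tb, tc)
-- say whether the head (tail) of a, b, c is the vertex; a detour satisfies
-- head c = head a, tail b = tail a, tail c = head b.  The hypotheses eI and eO
-- are the count-toggle3 equations for in- and out-degree.
switch-balance : ∀ I' I O' O {A B C} ha hb hc ta tb tc → Switchable A B C →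
  hc ≡ ha → tb ≡ ta → tc ≡ hb → I ≡ O →
  (eI : I' + (ind (A ∧ ha) + ind (B ∧ hb) + ind (C ∧ hc)) ≡ I + (ind (not A ∧ ha) + ind (not B ∧ hb) + ind (not C ∧ hc))) →
  (eO : O' + (ind (A ∧ ta) + ind (B ∧ tb) + ind (C ∧ tc)) ≡ O + (ind (not A ∧ ta) + ind (not B ∧ tb) + ind (not C ∧ tc))) →
  I' ≡ O'
switch-balance I' I O' O ha hb .ha ta .ta .hb (inj₁ (refl , refl , refl)) refl refl refl refl eI eO =
  trans (+-cancelʳ-≡ (ind ha) _ _ (trans (r₁ I' (ind ha)) (trans eI (r₂ O (ind hb) (ind ha)))))
        (sym (+-cancelʳ-≡ (ind ta) _ _ (trans (r₁ O' (ind ta)) (trans eO (r₃ O (ind ta) (ind hb))))))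
  where
  r₁ : ∀ p q → p + q ≡ p + (q + 0 + 0)
  r₁ = solve-∀
  r₂ : ∀ p q r → p + (0 + q + r) ≡ (p + q) + r
  r₂ = solve-∀
  r₃ : ∀ p q r → p + (0 + q + r) ≡ (p + r) + q
  r₃ = solve-∀
switch-balance I' I O' .I ha hb .ha ta .ta .hb (inj₂ (refl , refl , refl)) refl refl refl refl eI eO =
  +-cancelʳ-≡ (ind hb) _ _ (trans s₁ (sym s₂))
  where
  q₁ : ∀ p q r → p + q + r ≡ p + (0 + q + r)
  q₁ = solve-∀
  q₂ : ∀ p r → p + r ≡ p + (r + 0 + 0)
  q₂ = solve-∀
  q₃ : ∀ p q r → p + q + r ≡ p + (0 + r + q)
  q₃ = solve-∀
  s₁ : I' + ind hb ≡ I
  s₁ = +-cancelʳ-≡ (ind ha) _ _ (trans (q₁ I' (ind hb) (ind ha)) (trans eI (sym (q₂ I (ind ha)))))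
  s₂ : O' + ind hb ≡ I
  s₂ = +-cancelʳ-≡ (ind ta) _ _ (trans (q₃ O' (ind hb) (ind ta)) (trans eO (sym (q₂ I (ind ta)))))

switch-size : ∀ T H {A B C} → Switchable A B C →
  T + (ind (A ∧ true) + ind (B ∧ true) + ind (C ∧ true)) ≡ H + (ind (not A ∧ true) + ind (not B ∧ true) + ind (not C ∧ true)) →
  OffByOne H T
switch-size T H (inj₁ (refl , refl , refl)) eq = inj₁ (+-cancelʳ-≡ 1 _ _ (trans (r₁ T) (trans eq (r₂ H))))
  where
  r₁ : ∀ p → p + 1 ≡ p + (1 + 0 + 0)
  r₁ = solve-∀
  r₂ : ∀ p → p + (0 + 1 + 1) ≡ suc p + 1
  r₂ = solve-∀
switch-size T H (inj₂ (refl , refl , refl)) eq = inj₂ (+-cancelʳ-≡ 1 _ _ (trans (r₁ H) (trans (sym eq) (r₂ T))))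
  where
  r₁ : ∀ p → p + 1 ≡ p + (1 + 0 + 0)
  r₁ = solve-∀
  r₂ : ∀ p → p + (0 + 1 + 1) ≡ suc p + 1
  r₂ = solve-∀

module _ {A : Set} where

  private
    map-unique : ∀ (ι : A → A) (P : A → Set) (xs : List A) → All P xs →
                 (∀ x y → P x → P y → ι x ≡ ι y → x ≡ y) → Unique xs → Unique (map ι xs)
    map-unique ι P [] _ inj [] = []
    map-unique ι P (x ∷ xs) (px ∷ pxs) inj (x∉xs ∷ u) = distinct xs pxs x∉xs ∷ map-unique ι P xs pxs inj u
      where
      distinct : ∀ ys → All P ys → All (λ y → ¬ x ≡ y) ys → All (λ y → ¬ ι x ≡ y) (map ι ys)
      distinct [] _ _ = []
      distinct (y ∷ ys) (py ∷ pys) (x≢y ∷ x≢ys) = (x≢y ∘ inj x y px py) ∷ distinct ys pys x≢ys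

    filter-All : ∀ {P : A → Set} (P? : Decidable P) xs → All P (filter P? xs)
    filter-All P? xs = All.tabulate (λ x∈ → proj₂ (∈-filter⁻ P? {xs = xs} x∈))

  length-filter-involution :
    (L : List A) → Unique L → (∀ x → x ∈ₗ L) →
    {P Q : A → Set} (P? : Decidable P) (Q? : Decidable Q) (ι : A → A) →
    (∀ x → P x → Q (ι x)) → (∀ x → Q x → P (ι x)) →
    (∀ x → P x → ι (ι x) ≡ x) → (∀ x → Q x → ι (ι x) ≡ x) →
    length (filter P? L) ≡ length (filter Q? L)
  length-filter-involution L uL cL {P} {Q} P? Q? ι P→Q Q→P ιιP ιιQ =
    trans (sym (length-map ι (filter P? L)))
          (↭-length (∼bag⇒↭ (unique∧set⇒bag image-unique (Unique.filter⁺ Q? uL) (mk⇔ to from))))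
    where
    inj : ∀ x y → P x → P y → ι x ≡ ι y → x ≡ y
    inj x y px py e = trans (sym (ιιP x px)) (trans (cong ι e) (ιιP y py))
    image-unique : Unique (map ι (filter P? L))
    image-unique = map-unique ι P (filter P? L) (filter-All P? L) inj (Unique.filter⁺ P? uL)
    to : ∀ {z} → z ∈ₗ map ι (filter P? L) → z ∈ₗ filter Q? L
    to z∈ with ∈-map⁻ ι z∈
    ... | x , x∈ , refl = ∈-filter⁺ Q? (cL (ι x)) (P→Q x (proj₂ (∈-filter⁻ P? {xs = L} x∈)))
    from : ∀ {z} → z ∈ₗ filter Q? L → z ∈ₗ map ι (filter P? L)
    from {z} z∈ = subst (_∈ₗ map ι (filter P? L)) (ιιQ z qz) (∈-map⁺ ι (∈-filter⁺ P? (cL (ι z)) (Q→P z qz)))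
      where
      qz : Q z
      qz = proj₂ (∈-filter⁻ Q? {xs = L} z∈)

  length-filter-split : ∀ {P Q : A → Set} (P? : Decidable P) (Q? : Decidable Q) (L : List A) →
    length (filter P? L) ≡ length (filter (λ x → P? x ×-dec Q? x) L) + length (filter (λ x → P? x ×-dec ¬? (Q? x)) L)
  length-filter-split P? Q? [] = refl
  length-filter-split P? Q? (x ∷ L) with P? x | Q? x
  ... | yes _ | yes _ = cong suc (length-filter-split P? Q? L)
  ... | yes _ | no _  = trans (cong suc (length-filter-split P? Q? L)) (sym (+-suc _ _))
  ... | no _  | yes _ = length-filter-split P? Q? L
  ... | no _  | no _  = length-filter-split P? Q? L

  length-filter-singleton : ∀ {R : A → Set} (R? : Decidable R) (L : List A) (x : A) → Unique L → x ∈ₗ L →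
    (∀ y → R y → y ≡ x) → R x → length (filter R? L) ≡ 1
  length-filter-singleton R? L x uL x∈L only-x rx =
    ↭-length (∼bag⇒↭ (unique∧set⇒bag (Unique.filter⁺ R? uL) (All.[] ∷ []) (mk⇔ to from)))
    where
    to : ∀ {z} → z ∈ₗ filter R? L → z ∈ₗ (x ∷ [])
    to z∈ = here (only-x _ (proj₂ (∈-filter⁻ R? {xs = L} z∈)))
    from : ∀ {z} → z ∈ₗ (x ∷ []) → z ∈ₗ filter R? L
    from (here refl) = ∈-filter⁺ R? x∈L rx

allSubsets-complete : ∀ k (p : Subset k) → p ∈ₗ allSubsets k
allSubsets-complete zero [] = here refl
allSubsets-complete (suc k) (true ∷ p)  = ∈-++⁺ˡ (∈-map⁺ (inside ∷_) (allSubsets-complete k p))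
allSubsets-complete (suc k) (false ∷ p) =
  ∈-++⁺ʳ (map (inside ∷_) (allSubsets k)) (∈-map⁺ (outside ∷_) (allSubsets-complete k p))

allSubsets-unique : ∀ k → Unique (allSubsets k)
allSubsets-unique zero = All.[] ∷ []
allSubsets-unique (suc k) =
  Unique.++⁺ (Unique.map⁺ ∷-injective (allSubsets-unique k)) (Unique.map⁺ ∷-injective (allSubsets-unique k)) disjoint
  where
  ∷-injective : ∀ {b : Bool} {x y : Subset k} → _≡_ {A = Subset (suc k)} (b ∷ x) (b ∷ y) → x ≡ y
  ∷-injective refl = refl
  disjoint : ∀ {v} → ¬ (v ∈ₗ map (inside ∷_) (allSubsets k) × v ∈ₗ map (outside ∷_) (allSubsets k))
  disjoint (v∈₁ , v∈₂) with ∈-map⁻ (inside ∷_) v∈₁ | ∈-map⁻ (outside ∷_) v∈₂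
  ... | _ , _ , refl | _ , _ , ()

∈?-lookup : ∀ {k} (x : Fin k) (p : Subset k) → does (x ∈? p) ≡ lookup p x
∈?-lookup zero (inside ∷ p)  = refl
∈?-lookup zero (outside ∷ p) = refl
∈?-lookup (suc x) (b ∷ p) with x ∈? p | ∈?-lookup x p
... | yes _ | e = e
... | no _  | e = e

∣∣≡count : ∀ {k} (p : Subset k) → ∣ p ∣ ≡ count (lookup p)
∣∣≡count [] = refl
∣∣≡count (true ∷ p)  = cong suc (∣∣≡count p)
∣∣≡count (false ∷ p) = ∣∣≡count p

module Edges (G : Multigraph) where
  open Multigraph G

  joins? : ∀ e u w → Dec (Joins G e u w)
  joins? e u w = ((end₁ e ≟ u) ×-dec (end₂ e ≟ w)) ⊎-dec ((end₁ e ≟ w) ×-dec (end₂ e ≟ u))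

  adj? : ∀ u w → Dec (Adj G u w)
  adj? u w = any? (λ e → joins? e u w)

  joins-sym : ∀ {e u w} → Joins G e u w → Joins G e w u
  joins-sym (inj₁ (p , q)) = inj₂ (p , q)
  joins-sym (inj₂ (p , q)) = inj₁ (p , q)

  adj-sym : ∀ {u w} → Adj G u w → Adj G w u
  adj-sym (e , j) = e , joins-sym j

  joins-adj : ∀ {e u w} → Joins G e u w → Adj G u w
  joins-adj j = _ , j

  joins-inc : ∀ {e u w} → Joins G e u w → Inc G e u
  joins-inc (inj₁ (p , _)) = inj₁ p
  joins-inc (inj₂ (_ , q)) = inj₂ q

  joins-≢ : ∀ {e u w} → Joins G e u w → u ≢ w
  joins-≢ {e} (inj₁ (p , q)) refl = loopless e (trans p (sym q))
  joins-≢ {e} (inj₂ (p , q)) refl = loopless e (trans p (sym q))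

  -- the first edge joining u and w (the default d if there is none)
  edge-between : Fin m → Fin n → Fin n → Fin m
  edge-between d u w = Maybe.fromMaybe d (first (λ e → does (joins? e u w)))

  edge-between-joins : ∀ {u w} → Adj G u w → ∀ d → Joins G (edge-between d u w) u w
  edge-between-joins {u} {w} (e , j) d with first-total (λ e' → does (joins? e' u w)) e (dec-true (joins? e u w) j)
  ... | i , eq rewrite eq = dec-sound (joins? i u w) (first-just (λ e' → does (joins? e' u w)) eq)

-- Reachability in G - Y is decidable because a walk
-- can be shortened to at most n steps; every vertex outside Y then gets a
-- canonical representative of its component: the first vertex reachable
-- from it.

module Components (G : Multigraph) (Y : Subset (Multigraph.n G)) where
  open Multigraph G
  open Edges G

  outY : Fin n → Bool
  outY z = not (does (z ∈? Y))

  outY-sound : ∀ {z} → outY z ≡ true → z ∉ Y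
  outY-sound {z} h z∈Y with z ∈? Y
  outY-sound {z} () z∈Y | yes _
  ... | no z∉Y = z∉Y z∈Y

  outY-complete : ∀ {z} → z ∉ Y → outY z ≡ true
  outY-complete {z} z∉Y rewrite dec-false (z ∈? Y) z∉Y = refl

  outY-false : ∀ {z} → z ∈ Y → outY z ≡ false
  outY-false {z} z∈Y rewrite dec-true (z ∈? Y) z∈Y = refl

  data Walk≤ (p : Fin n → Bool) : ℕ → Fin n → Fin n → Set where
    here : ∀ {k u} → p u ≡ true → Walk≤ p k u u
    step : ∀ {k u w v} → p u ≡ true → Adj G u w → Walk≤ p k w v → Walk≤ p (suc k) u v

  walk-start : ∀ {p k u v} → Walk≤ p k u v → p u ≡ true
  walk-start (here pu)     = pu
  walk-start (step pu _ _) = pu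

  walk-end : ∀ {p k u v} → Walk≤ p k u v → p v ≡ true
  walk-end (here pv)     = pv
  walk-end (step _ _ r) = walk-end r

  walk? : ∀ p k u v → Dec (Walk≤ p k u v)
  walk? p zero u v = map′ to from ((u ≟ v) ×-dec bool? (p u))
    where
    to : u ≡ v × p u ≡ true → Walk≤ p zero u v
    to (refl , pu) = here pu
    from : Walk≤ p zero u v → u ≡ v × p u ≡ true
    from (here pu) = refl , pu
  walk? p (suc k) u v =
    map′ to from (((u ≟ v) ×-dec bool? (p u)) ⊎-dec (bool? (p u) ×-dec any? (λ w → adj? u w ×-dec walk? p k w v)))
    where
    to : (u ≡ v × p u ≡ true) ⊎ (p u ≡ true × ∃ λ w → Adj G u w × Walk≤ p k w v) → Walk≤ p (suc k) u v
    to (inj₁ (refl , pu)) = here pu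
    to (inj₂ (pu , w , a , r)) = step pu a r
    from : Walk≤ p (suc k) u v → (u ≡ v × p u ≡ true) ⊎ (p u ≡ true × ∃ λ w → Adj G u w × Walk≤ p k w v)
    from (here pu) = inj₁ (refl , pu)
    from (step pu a r) = inj₂ (pu , _ , a , r)

  walk-weaken : ∀ {p k k' u v} → k ≤ k' → Walk≤ p k u v → Walk≤ p k' u v
  walk-weaken k≤k' (here pu) = here pu
  walk-weaken (s≤s k≤k') (step pu a r) = step pu a (walk-weaken k≤k' r)

  walk-widen : ∀ {p q k u v} → (∀ z → p z ≡ true → q z ≡ true) → Walk≤ p k u v → Walk≤ q k u v
  walk-widen p⊆q (here pu) = here (p⊆q _ pu)
  walk-widen p⊆q (step pu a r) = step (p⊆q _ pu) a (walk-widen p⊆q r)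

  walk-snoc : ∀ {p k u v z} → Walk≤ p k u v → Adj G v z → p z ≡ true → Walk≤ p (suc k) u z
  walk-snoc (here pu) a pz = step pu a (here pz)
  walk-snoc (step pu a r) a' pz = step pu a (walk-snoc r a' pz)

  walk-reverse : ∀ {p k u v} → Walk≤ p k u v → Walk≤ p k v u
  walk-reverse (here pu) = here pu
  walk-reverse (step pu a r) = walk-snoc (walk-reverse r) (adj-sym a) pu

  walk-++ : ∀ {p k k' u v w} → Walk≤ p k u v → Walk≤ p k' v w → Walk≤ p (k + k') u w
  walk-++ {k = k} (here _) r = walk-weaken (m≤n+m _ k) r
  walk-++ (step pu a r) r' = step pu a (walk-++ r r')

  remove : (Fin n → Bool) → Fin n → Fin n → Bool
  remove p u z = p z ∧ not (does (z ≟ u))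

  remove-⊆ : ∀ p u z → remove p u z ≡ true → p z ≡ true
  remove-⊆ p u z = ∧-proj₁

  remove-keeps : ∀ {p u z} → p z ≡ true → z ≢ u → remove p u z ≡ true
  remove-keeps {p} {u} {z} pz z≢u rewrite pz | dec-false (z ≟ u) z≢u = refl

  remove-count : ∀ p u → p u ≡ true → suc (count (remove p u)) ≡ count p
  remove-count p u pu = sym (begin
      count p                                        ≡⟨ sym (+-identityʳ _) ⟩
      count p + 0                                    ≡⟨ cong₂ _+_ (count-ext _ _ restore) (cong ind (sym u-removed)) ⟩
      count (upd (remove p u) u (p u)) + ind (remove p u u) ≡⟨ count-upd (remove p u) u (p u) ⟩
      count (remove p u) + ind (p u)                 ≡⟨ cong (λ b → count (remove p u) + ind b) pu ⟩
      count (remove p u) + 1                         ≡⟨ +-comm _ 1 ⟩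
      suc (count (remove p u))                       ∎)
    where
    open ≡-Reasoning
    u-removed : remove p u u ≡ false
    u-removed rewrite dec-true (u ≟ u) refl = ∧-zeroʳ (p u)
    restore : ∀ z → p z ≡ upd (remove p u) u (p u) z
    restore z with z ≟ u
    ... | yes refl = refl
    ... | no _ = sym (∧-identityʳ (p z))

  SomeWalk : (Fin n → Bool) → Fin n → Fin n → Set
  SomeWalk p u v = ∃ λ k → Walk≤ p k u v

  avoid : ∀ {p k w v} u → Walk≤ p k w v →
          SomeWalk (remove p u) w v ⊎ (u ≡ v) ⊎ (∃ λ w' → Adj G u w' × SomeWalk (remove p u) w' v)
  avoid {p} {w = w} u (here pw) with w ≟ u
  ... | yes refl = inj₂ (inj₁ refl)
  ... | no w≢u   = inj₁ (0 , here (remove-keeps {p} pw w≢u))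
  avoid {p} {w = w} u (step {w = w'} pw a r) with avoid u r
  ... | inj₂ x = inj₂ x
  ... | inj₁ (k , r') with w ≟ u
  ...   | yes refl = inj₂ (inj₂ (w' , a , k , r'))
  ...   | no w≢u   = inj₁ (suc k , step (remove-keeps {p} pw w≢u) a r')

  shorten : ∀ c p {k u v} → count p ≡ c → Walk≤ p k u v → Walk≤ p c u v
  shorten zero p eq r = ⊥-elim (1+n≢0 (trans (remove-count p _ (walk-start r)) eq))
  shorten (suc c) p eq (here pu) = here pu
  shorten (suc c) p {u = u} eq (step pu a r) with avoid u r
  ... | inj₁ (_ , r') = step pu a (walk-widen (remove-⊆ p u) (shorten c (remove p u) count-eq r'))
    where count-eq = suc-injective (trans (remove-count p u pu) eq)
  ... | inj₂ (inj₁ refl) = here pu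
  ... | inj₂ (inj₂ (_ , a' , _ , r')) = step pu a' (walk-widen (remove-⊆ p u) (shorten c (remove p u) count-eq r'))
    where count-eq = suc-injective (trans (remove-count p u pu) eq)

  Conn : Fin n → Fin n → Set
  Conn u v = Walk≤ outY n u v

  conn? : ∀ u v → Dec (Conn u v)
  conn? u v = walk? outY n u v

  walk⇒conn : ∀ {k u v} → Walk≤ outY k u v → Conn u v
  walk⇒conn r = walk-weaken (count-≤ outY) (shorten _ outY refl r)

  conn-refl : ∀ {u} → u ∉ Y → Conn u u
  conn-refl u∉Y = here (outY-complete u∉Y)

  conn-sym : ∀ {u v} → Conn u v → Conn v u
  conn-sym = walk-reverse

  conn-trans : ∀ {u v w} → Conn u v → Conn v w → Conn u w
  conn-trans r r' = walk⇒conn (walk-++ r r')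

  conn-end : ∀ {u v} → Conn u v → v ∉ Y
  conn-end r = outY-sound (walk-end r)

  conn-adj : ∀ {u w} → u ∉ Y → w ∉ Y → Adj G u w → Conn u w
  conn-adj u∉Y w∉Y a = walk⇒conn {k = 1} (step (outY-complete u∉Y) a (here (outY-complete w∉Y)))

  Walk⇒conn : ∀ {u v} → Walk G (_∉ Y) u v → Conn u v
  Walk⇒conn r = walk⇒conn (proj₂ (lengthen r))
    where
    lengthen : ∀ {u v} → Walk G (_∉ Y) u v → SomeWalk outY u v
    lengthen (here u∉Y) = 0 , here (outY-complete u∉Y)
    lengthen (step u∉Y a r) = let (k , r') = lengthen r in suc k , step (outY-complete u∉Y) a r'

  conn⇒Walk : ∀ {k u v} → Walk≤ outY k u v → Walk G (_∉ Y) u v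
  conn⇒Walk (here pu) = here (outY-sound pu)
  conn⇒Walk (step pu a r) = step (outY-sound pu) a (conn⇒Walk r)

  abstract
    rep : Fin n → Fin n
    rep u = Maybe.fromMaybe u (first (λ v → does (conn? u v)))

    conn-rep : ∀ {u} → u ∉ Y → Conn u (rep u)
    conn-rep {u} u∉Y with first-total (λ v → does (conn? u v)) u (dec-true (conn? u u) (conn-refl u∉Y))
    ... | i , e rewrite e = dec-sound (conn? u i) (first-just (λ v → does (conn? u v)) e)

    rep-cong : ∀ {u u'} → Conn u u' → rep u ≡ rep u'
    rep-cong {u} {u'} r
      rewrite first-ext (λ v → does (conn? u v)) (λ v → does (conn? u' v))
                (λ v → does-⇔ (mk⇔ (conn-trans (conn-sym r)) (conn-trans r)) (conn? u v) (conn? u' v))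
      with first (λ v → does (conn? u' v)) in e
    ... | just _  = refl
    ... | nothing with trans (sym (first-nothing (λ v → does (conn? u' v)) e u')) (dec-true (conn? u' u') (conn-refl (conn-end r)))
    ...   | ()

module Lemma3-1 (G : Multigraph) (f : Fin (Multigraph.n G) → ℕ)
                (F : Subset (Multigraph.m G)) (Y : Subset (Multigraph.n G))
                (hyp1 : Hyp1 G Y) (hyp2 : Hyp2 G f Y) (hyp3 : Hyp3 G f F Y) (hyp4 : Hyp4 G F Y) where

  open Multigraph G
  open Edges G
  open Components G Y

  ∈-∉-≢ : ∀ {a b} → a ∈ Y → b ∉ Y → a ≢ b
  ∈-∉-≢ a∈Y b∉Y refl = b∉Y a∈Y

  edge-unique : ∀ {e e' a b} → Joins G e a b → Joins G e' a b → a ∉ Y → e ≡ e'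
  edge-unique {e} {e'} j j' a∉Y with e ≟ e'
  ... | yes e≡e' = e≡e'
  ... | no e≢e' = ⊥-elim (parallel j)
    where
    parallel : Joins G e _ _ → ⊥
    parallel (inj₁ (p , q)) = a∉Y (subst (_∈ Y) p (proj₁ (hyp1 e e' e≢e' (subst₂ (Joins G e') (sym p) (sym q) j'))))
    parallel (inj₂ (p , q)) = a∉Y (subst (_∈ Y) q (proj₂ (hyp1 e e' e≢e' (subst₂ (Joins G e') (sym p) (sym q) (joins-sym j')))))

  record Anchors : Set where
    constructor anchors
    field
      x₁ x₂ y₁ y₂ : Fin n
      two-exits : Bool        -- case (a) of (4); in case (b) y₂ is irrelevant

  -- The anchors of the component T of L.  The entrance edge x₁y₁ ∈ F will be
  -- the only edge oriented into T; in case (a) x₁ and x₂ are named so that y₂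
  -- has the smaller index.
  record IsAnchors (L : Fin n) (A : Anchors) : Set where
    open Anchors A
    field
      x₁≢x₂ : x₁ ≢ x₂
      x₁∈T : InComp G Y L x₁
      x₂∈T : InComp G Y L x₂
      twins : ∀ w → InClosedNbhd G (InComp G Y L) x₁ w ⇔ InClosedNbhd G (InComp G Y L) x₂ w
      entrance : Fin m
      entrance∈F : entrance ∈ F
      entrance-joins : Joins G entrance x₁ y₁
      nbhdY₁ : NbhdInYIs G Y x₁ y₁
      nbhdY₂ : (two-exits ≡ true × NbhdInYIs G Y x₂ y₂ × toℕ y₂ < toℕ y₁)
             ⊎ (two-exits ≡ false × NoNbrInY G Y x₂)

  anchors-of : ∀ L → L ∉ Y → Σ Anchors (IsAnchors L)
  anchors-of L L∉Y with hyp4 L L∉Y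
  ... | x₁ , x₂ , x₁≢x₂ , x₁∈T , x₂∈T , twins , _ , inj₂ (noY₂ , y₁ , (e₁ , e₁∈F , j₁) , N₁) =
    anchors x₁ x₂ y₁ y₁ false ,
    record { x₁≢x₂ = x₁≢x₂ ; x₁∈T = x₁∈T ; x₂∈T = x₂∈T ; twins = twins ; entrance = e₁ ; entrance∈F = e₁∈F
           ; entrance-joins = j₁ ; nbhdY₁ = N₁ ; nbhdY₂ = inj₂ (refl , noY₂) }
  ... | x₁ , x₂ , x₁≢x₂ , x₁∈T , x₂∈T , twins , _ , inj₁ (y₁ , y₂ , (e₁ , e₁∈F , j₁) , (e₂ , e₂∈F , j₂) , y₁≢y₂ , N₁ , N₂)
    with toℕ y₂ <? toℕ y₁
  ...  | yes y₂<y₁ =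
    anchors x₁ x₂ y₁ y₂ true ,
    record { x₁≢x₂ = x₁≢x₂ ; x₁∈T = x₁∈T ; x₂∈T = x₂∈T ; twins = twins ; entrance = e₁ ; entrance∈F = e₁∈F
           ; entrance-joins = j₁ ; nbhdY₁ = N₁ ; nbhdY₂ = inj₁ (refl , N₂ , y₂<y₁) }
  ...  | no y₂≮y₁ =
    anchors x₂ x₁ y₂ y₁ true ,
    record { x₁≢x₂ = x₁≢x₂ ∘ sym ; x₁∈T = x₂∈T ; x₂∈T = x₁∈T ; twins = λ w → ⇔-sym (twins w)
           ; entrance = e₂ ; entrance∈F = e₂∈F ; entrance-joins = j₂ ; nbhdY₁ = N₂
           ; nbhdY₂ = inj₁ (refl , N₁ , ≤∧≢⇒< (≮⇒≥ y₂≮y₁) (y₁≢y₂ ∘ toℕ-injective)) }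

  abstract
    anchorsAt : Fin n → Anchors
    anchorsAt L with L ∈? Y
    ... | yes _   = anchors L L L L false
    ... | no L∉Y = proj₁ (anchors-of L L∉Y)

    anchorsAt-ok : ∀ L → L ∉ Y → IsAnchors L (anchorsAt L)
    anchorsAt-ok L L∉Y with L ∈? Y
    ... | yes L∈Y = ⊥-elim (L∉Y L∈Y)
    ... | no L∉Y' = proj₂ (anchors-of L L∉Y')

  open IsAnchors

  X₁ X₂ Y₁ Y₂ : Fin n → Fin n
  X₁ t = Anchors.x₁ (anchorsAt (rep t))
  X₂ t = Anchors.x₂ (anchorsAt (rep t))
  Y₁ t = Anchors.y₁ (anchorsAt (rep t))
  Y₂ t = Anchors.y₂ (anchorsAt (rep t))

  TwoExits : Fin n → Bool
  TwoExits t = Anchors.two-exits (anchorsAt (rep t))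

  anchors-ok : ∀ {t} → t ∉ Y → IsAnchors (rep t) (anchorsAt (rep t))
  anchors-ok {t} t∉Y = anchorsAt-ok (rep t) (conn-end (conn-rep t∉Y))

  rep-member : ∀ {t z} → t ∉ Y → InComp G Y (rep t) z → rep z ≡ rep t
  rep-member t∉Y z∈T = trans (sym (rep-cong (Walk⇒conn z∈T))) (sym (rep-cong (conn-rep t∉Y)))

  rep-adj : ∀ {u w} → u ∉ Y → w ∉ Y → Adj G u w → rep u ≡ rep w
  rep-adj u∉Y w∉Y a = rep-cong (conn-adj u∉Y w∉Y a)

  rep-X₁ : ∀ {t} → t ∉ Y → rep (X₁ t) ≡ rep t
  rep-X₁ t∉Y = rep-member t∉Y (x₁∈T (anchors-ok t∉Y))

  rep-X₂ : ∀ {t} → t ∉ Y → rep (X₂ t) ≡ rep t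
  rep-X₂ t∉Y = rep-member t∉Y (x₂∈T (anchors-ok t∉Y))

  X₁∉Y : ∀ {t} → t ∉ Y → X₁ t ∉ Y
  X₁∉Y t∉Y = conn-end (Walk⇒conn (x₁∈T (anchors-ok t∉Y)))

  X₂∉Y : ∀ {t} → t ∉ Y → X₂ t ∉ Y
  X₂∉Y t∉Y = conn-end (Walk⇒conn (x₂∈T (anchors-ok t∉Y)))

  conn-X₁ : ∀ {t} → t ∉ Y → Conn t (X₁ t)
  conn-X₁ t∉Y = conn-trans (conn-rep t∉Y) (Walk⇒conn (x₁∈T (anchors-ok t∉Y)))

  Y₁∈Y : ∀ {t} → t ∉ Y → Y₁ t ∈ Y
  Y₁∈Y t∉Y = proj₁ (Equivalence.from (nbhdY₁ (anchors-ok t∉Y) _) refl)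

  reaches-within : Fin n → Fin (suc n) → Bool
  reaches-within t k = does (walk? outY (toℕ k) t (X₁ t))

  abstract
    dist : Fin n → ℕ
    dist t = toℕ (Maybe.fromMaybe zero (first (reaches-within t)))

    dist-walk : ∀ {t} → t ∉ Y → Walk≤ outY (dist t) t (X₁ t)
    dist-walk {t} t∉Y
      with first-total (reaches-within t) (fromℕ< (n<1+n n))
             (dec-true (walk? outY _ t (X₁ t)) (subst (λ k → Walk≤ outY k t (X₁ t)) (sym (toℕ-fromℕ< (n<1+n n))) (conn-X₁ t∉Y)))
    ... | i , e rewrite e = dec-sound (walk? outY _ t (X₁ t)) (first-just (reaches-within t) e)

    dist-min : ∀ {t k} → k ≤ n → Walk≤ outY k t (X₁ t) → dist t ≤ k
    dist-min {t} {k} k≤n r with first (reaches-within t) in e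
    ... | just i = subst (toℕ i ≤_) (toℕ-fromℕ< (s≤s k≤n))
                     (first-min (reaches-within t) (fromℕ< (s≤s k≤n)) e
                       (dec-true (walk? outY _ t (X₁ t)) (subst (λ k → Walk≤ outY k t (X₁ t)) (sym (toℕ-fromℕ< (s≤s k≤n))) r)))
    ... | nothing = z≤n

    dist≤n : ∀ t → dist t ≤ n
    dist≤n t = ≤-pred (toℕ<n (Maybe.fromMaybe zero (first (reaches-within t))))

  private
    first-step : ∀ {p k a b} → Walk≤ p k a b →
                 (a ≡ b) ⊎ (∃ λ k' → k ≡ suc k' × ∃ λ u → Adj G a u × Walk≤ p k' u b)
    first-step (here _) = inj₁ refl
    first-step (step _ a r) = inj₂ (_ , refl , _ , a , r)

  closer-neighbour : ∀ {t} → t ∉ Y → t ≢ X₁ t → ∃ λ u → Adj G t u × u ∉ Y × dist u < dist t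
  closer-neighbour {t} t∉Y t≢x₁ with first-step (dist-walk t∉Y)
  ... | inj₁ eq = ⊥-elim (t≢x₁ eq)
  ... | inj₂ (k' , eq , u , a , r) = u , a , u∉Y , dist-u<dist-t
    where
    u∉Y : u ∉ Y
    u∉Y = outY-sound (walk-start r)
    r' : Walk≤ outY k' u (X₁ u)
    r' = subst (λ L → Walk≤ outY k' u (Anchors.x₁ (anchorsAt L))) (rep-adj t∉Y u∉Y a) r
    k'≤n : k' ≤ n
    k'≤n = ≤-pred (≤-trans (≤-reflexive (sym eq)) (m≤n⇒m≤1+n (dist≤n t)))
    dist-u<dist-t : dist u < dist t
    dist-u<dist-t = ≤-trans (s≤s (dist-min k'≤n r')) (≤-reflexive (sym eq))

  -- Y lies below G - Y (ordered by index); in each component x₁ is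
  -- highest, x₂ next, and the other vertices are ordered by increasing
  -- distance from x₁ (ties broken by index).

  -- x₁ gets rank n + K + 1 and x₂ rank n + K, above all ordinary vertices
  K : ℕ
  K = n * n + n

  -- rank of an ordinary vertex of G - Y: decreasing in the distance, injective
  κ : Fin n → ℕ
  κ t = (n ∸ dist t) * n + toℕ t

  isX₁ isX₂ : Fin n → Bool
  isX₁ t = does (t ≟ X₁ t)
  isX₂ t = does (t ≟ X₂ t)

  abstract
    rank : Fin n → ℕ
    rank t = if outY t then n + (if isX₁ t then suc K else if isX₂ t then K else κ t) else toℕ t

    rank-Y : ∀ {z} → z ∈ Y → rank z ≡ toℕ z
    rank-Y z∈Y rewrite outY-false z∈Y = refl

    rank-x₁ : ∀ {z} → z ∉ Y → z ≡ X₁ z → rank z ≡ n + suc K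
    rank-x₁ {z} z∉Y z≡x₁ rewrite outY-complete z∉Y | dec-true (z ≟ X₁ z) z≡x₁ = refl

    rank-x₂ : ∀ {z} → z ∉ Y → z ≢ X₁ z → z ≡ X₂ z → rank z ≡ n + K
    rank-x₂ {z} z∉Y z≢x₁ z≡x₂ rewrite outY-complete z∉Y | dec-false (z ≟ X₁ z) z≢x₁ | dec-true (z ≟ X₂ z) z≡x₂ = refl

    rank-other : ∀ {z} → z ∉ Y → z ≢ X₁ z → z ≢ X₂ z → rank z ≡ n + κ z
    rank-other {z} z∉Y z≢x₁ z≢x₂ rewrite outY-complete z∉Y | dec-false (z ≟ X₁ z) z≢x₁ | dec-false (z ≟ X₂ z) z≢x₂ = refl

  lex-< : ∀ {a b i n} j → a < b → i < n → a * n + i < b * n + j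
  lex-< {a} {b} {i} {n} j a<b i<n = begin-strict
      a * n + i <⟨ +-monoʳ-< (a * n) i<n ⟩
      a * n + n ≡⟨ +-comm (a * n) n ⟩
      suc a * n ≤⟨ *-monoˡ-≤ n a<b ⟩
      b * n     ≤⟨ m≤m+n (b * n) j ⟩
      b * n + j ∎
    where open ≤-Reasoning

  lex-injective : ∀ {a b i j n} → a * n + i ≡ b * n + j → i < n → j < n → i ≡ j
  lex-injective {a} {b} {i} {j} {n} eq i<n j<n with <-cmp a b
  ... | tri< a<b _ _ = ⊥-elim (<-irrefl eq (lex-< j a<b i<n))
  ... | tri> _ _ a>b = ⊥-elim (<-irrefl (sym eq) (lex-< i a>b j<n))
  ... | tri≈ _ refl _ = +-cancelˡ-≡ (a * n) i j eq

  κ<K : ∀ t → κ t < K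
  κ<K t = +-mono-≤-< (*-monoˡ-≤ n (m∸n≤m n (dist t))) (toℕ<n t)

  X₁-cong : ∀ {a b} → rep a ≡ rep b → X₁ a ≡ X₁ b
  X₁-cong = cong (λ L → Anchors.x₁ (anchorsAt L))

  X₂-cong : ∀ {a b} → rep a ≡ rep b → X₂ a ≡ X₂ b
  X₂-cong = cong (λ L → Anchors.x₂ (anchorsAt L))

  rank-Y< : ∀ {z} → z ∈ Y → rank z < n
  rank-Y< {z} z∈Y = subst (_< n) (sym (rank-Y z∈Y)) (toℕ<n z)

  rank-T≥ : ∀ {z} → z ∉ Y → n ≤ rank z
  rank-T≥ {z} z∉Y = by-kind (z ≟ X₁ z) (z ≟ X₂ z)
    where
    by-kind : Dec (z ≡ X₁ z) → Dec (z ≡ X₂ z) → n ≤ rank z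
    by-kind (yes z≡x₁) _ = subst (n ≤_) (sym (rank-x₁ z∉Y z≡x₁)) (m≤m+n n _)
    by-kind (no z≢x₁) (yes z≡x₂) = subst (n ≤_) (sym (rank-x₂ z∉Y z≢x₁ z≡x₂)) (m≤m+n n _)
    by-kind (no z≢x₁) (no z≢x₂) = subst (n ≤_) (sym (rank-other z∉Y z≢x₁ z≢x₂)) (m≤m+n n _)

  rank-other< : ∀ {z} → z ∉ Y → z ≢ X₁ z → z ≢ X₂ z → rank z < n + K
  rank-other< {z} z∉Y z≢x₁ z≢x₂ = subst (_< n + K) (sym (rank-other z∉Y z≢x₁ z≢x₂)) (+-monoʳ-< n (κ<K z))

  rank-not-x₁< : ∀ {z} → z ∉ Y → z ≢ X₁ z → rank z < n + suc K
  rank-not-x₁< {z} z∉Y z≢x₁ = by-kind (z ≟ X₂ z)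
    where
    by-kind : Dec (z ≡ X₂ z) → rank z < n + suc K
    by-kind (yes z≡x₂) = subst (_< n + suc K) (sym (rank-x₂ z∉Y z≢x₁ z≡x₂)) (+-monoʳ-< n (n<1+n K))
    by-kind (no z≢x₂)  = <-trans (rank-other< z∉Y z≢x₁ z≢x₂) (+-monoʳ-< n (n<1+n K))

  rank-closer : ∀ {u v} → u ∉ Y → v ∉ Y → v ≢ X₁ v → v ≢ X₂ v →
                dist u < dist v → rank v < rank u
  rank-closer {u} {v} u∉Y v∉Y v≢x₁ v≢x₂ closer = by-kind (u ≟ X₁ u) (u ≟ X₂ u)
    where
    by-kind : Dec (u ≡ X₁ u) → Dec (u ≡ X₂ u) → rank v < rank u
    by-kind (yes u≡x₁) _ =
      subst (rank v <_) (sym (rank-x₁ u∉Y u≡x₁)) (<-trans (rank-other< v∉Y v≢x₁ v≢x₂) (+-monoʳ-< n (n<1+n K)))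
    by-kind (no u≢x₁) (yes u≡x₂) = subst (rank v <_) (sym (rank-x₂ u∉Y u≢x₁ u≡x₂)) (rank-other< v∉Y v≢x₁ v≢x₂)
    by-kind (no u≢x₁) (no u≢x₂) =
      subst₂ _<_ (sym (rank-other v∉Y v≢x₁ v≢x₂)) (sym (rank-other u∉Y u≢x₁ u≢x₂))
        (+-monoʳ-< n (lex-< (toℕ u) (∸-monoʳ-< closer (dist≤n v)) (toℕ<n v)))

  rank-adj-≢ : ∀ {e u w} → Joins G e u w → rank u ≢ rank w
  rank-adj-≢ {e} {u} {w} j eq = by-side (u ∈? Y) (w ∈? Y)
    where
    by-side : Dec (u ∈ Y) → Dec (w ∈ Y) → ⊥
    by-side (yes u∈Y) (yes w∈Y) = joins-≢ j (toℕ-injective (trans (sym (rank-Y u∈Y)) (trans eq (rank-Y w∈Y))))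
    by-side (yes u∈Y) (no w∉Y) = <-irrefl eq (<-≤-trans (rank-Y< u∈Y) (rank-T≥ w∉Y))
    by-side (no u∉Y) (yes w∈Y) = <-irrefl (sym eq) (<-≤-trans (rank-Y< w∈Y) (rank-T≥ u∉Y))
    by-side (no u∉Y) (no w∉Y) = inside-T (u ≟ X₁ u) (w ≟ X₁ w)
      where
      same : rep u ≡ rep w
      same = rep-adj u∉Y w∉Y (joins-adj j)
      others : u ≢ X₁ u → w ≢ X₁ w → Dec (u ≡ X₂ u) → Dec (w ≡ X₂ w) → ⊥
      others _ _ (yes u≡x₂) (yes w≡x₂) = joins-≢ j (trans u≡x₂ (trans (X₂-cong same) (sym w≡x₂)))
      others u≢x₁ w≢x₁ (yes u≡x₂) (no w≢x₂) =
        <-irrefl (sym eq) (subst (rank w <_) (sym (rank-x₂ u∉Y u≢x₁ u≡x₂)) (rank-other< w∉Y w≢x₁ w≢x₂))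
      others u≢x₁ w≢x₁ (no u≢x₂) (yes w≡x₂) =
        <-irrefl eq (subst (rank u <_) (sym (rank-x₂ w∉Y w≢x₁ w≡x₂)) (rank-other< u∉Y u≢x₁ u≢x₂))
      others u≢x₁ w≢x₁ (no u≢x₂) (no w≢x₂) =
        joins-≢ j (toℕ-injective (lex-injective {n ∸ dist u} {n ∸ dist w}
          (+-cancelˡ-≡ n _ _ (trans (sym (rank-other u∉Y u≢x₁ u≢x₂)) (trans eq (rank-other w∉Y w≢x₁ w≢x₂))))
          (toℕ<n u) (toℕ<n w)))
      inside-T : Dec (u ≡ X₁ u) → Dec (w ≡ X₁ w) → ⊥
      inside-T (yes u≡x₁) (yes w≡x₁) = joins-≢ j (trans u≡x₁ (trans (X₁-cong same) (sym w≡x₁)))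
      inside-T (yes u≡x₁) (no w≢x₁) = <-irrefl (sym eq) (subst (rank w <_) (sym (rank-x₁ u∉Y u≡x₁)) (rank-not-x₁< w∉Y w≢x₁))
      inside-T (no u≢x₁) (yes w≡x₁) = <-irrefl eq (subst (rank u <_) (sym (rank-x₁ w∉Y w≡x₁)) (rank-not-x₁< u∉Y u≢x₁))
      inside-T (no u≢x₁) (no w≢x₁) = others u≢x₁ w≢x₁ (u ≟ X₂ u) (w ≟ X₂ w)

  -- The orientation D.  Edges go from higher to lower rank, except that
  -- the entrance edge of each component goes from y₁ to x₁.

  Entrance : Fin n → Fin n → Bool
  Entrance u w = outY u ∧ isX₁ u ∧ does (w ≟ Y₁ u)

  orient : Bool → Bool → Bool → Bool
  orient entrance₁ entrance₂ rank₂<rank₁ =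
    if entrance₁ then false else if entrance₂ then true else rank₂<rank₁

  abstract
    D : Orientation G
    D e = orient (Entrance (end₁ e) (end₂ e)) (Entrance (end₂ e) (end₁ e)) (does (rank (end₂ e) <? rank (end₁ e)))

    D-def : ∀ e → D e ≡ orient (Entrance (end₁ e) (end₂ e)) (Entrance (end₂ e) (end₁ e)) (does (rank (end₂ e) <? rank (end₁ e)))
    D-def e = refl

  tl hd : Fin m → Fin n
  tl = tail G D
  hd = head G D

  tl-joins : ∀ e → Joins G e (tl e) (hd e)
  tl-joins e with D e
  ... | true  = inj₁ (refl , refl)
  ... | false = inj₂ (refl , refl)

  private
    forward : ∀ e → D e ≡ true → tl e ≡ end₁ e × hd e ≡ end₂ e
    forward e De rewrite De = refl , refl

    backward : ∀ e → D e ≡ false → tl e ≡ end₂ e × hd e ≡ end₁ e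
    backward e De rewrite De = refl , refl

  -- an entrance edge is an entrance from one side only (y₁ lies in Y)
  entrance-asym : ∀ {u w} → Entrance u w ≡ true → Entrance w u ≡ false
  entrance-asym {u} {w} ent
    rewrite outY-false {w} (subst (_∈ Y) (sym (dec-sound (w ≟ Y₁ u) (∧-proj₂ {isX₁ u} (∧-proj₂ {outY u} ent))))
                                  (Y₁∈Y (outY-sound (∧-proj₁ ent)))) = refl

  orient-entrance : ∀ {e u w} → Joins G e u w → Entrance u w ≡ true → tl e ≡ w × hd e ≡ u
  orient-entrance {e} (inj₁ (refl , refl)) ent =
    backward e (trans (D-def e) (cong (λ b → orient b (Entrance (end₂ e) (end₁ e)) (does (rank (end₂ e) <? rank (end₁ e)))) ent))
  orient-entrance {e} (inj₂ (refl , refl)) ent =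
    forward e (trans (D-def e) (cong₂ (λ b b' → orient b b' (does (rank (end₂ e) <? rank (end₁ e)))) (entrance-asym {end₂ e} {end₁ e} ent) ent))

  orient-rank : ∀ {e u w} → Joins G e u w → Entrance u w ≡ false → Entrance w u ≡ false →
                rank w < rank u → tl e ≡ u × hd e ≡ w
  orient-rank {e} {u} {w} (inj₁ (refl , refl)) ¬uw ¬wu w<u =
    forward e (trans (D-def e) (cong₃ orient ¬uw ¬wu (dec-true (rank w <? rank u) w<u)))
  orient-rank {e} {u} {w} (inj₂ (refl , refl)) ¬uw ¬wu w<u =
    backward e (trans (D-def e) (cong₃ orient ¬wu ¬uw (dec-false (rank u <? rank w) (<⇒≯ w<u))))

  not-entrance-into-T : ∀ {u w} → w ∉ Y → Entrance u w ≡ false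
  not-entrance-into-T {u} {w} w∉Y with u ∈? Y
  ... | yes _ = refl
  ... | no u∉Y rewrite dec-false (w ≟ Y₁ u) (λ w≡y₁ → ∈-∉-≢ (Y₁∈Y u∉Y) w∉Y (sym w≡y₁)) = ∧-zeroʳ (isX₁ u)

  not-entrance-from-Y : ∀ {u w} → u ∈ Y → Entrance u w ≡ false
  not-entrance-from-Y u∈Y rewrite outY-false u∈Y = refl

  not-entrance-from-other : ∀ {z v} → z ≢ X₁ z → Entrance z v ≡ false
  not-entrance-from-other {z} {v} z≢x₁ =
    trans (cong (λ b → outY z ∧ b ∧ does (v ≟ Y₁ z)) (dec-false (z ≟ X₁ z) z≢x₁)) (∧-zeroʳ (outY z))

  tail-rank : ∀ {e u w} → Joins G e u w → Entrance u w ≡ false → Entrance w u ≡ false → tl e ≡ u → rank w < rank u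
  tail-rank {e} {u} {w} j ¬uw ¬wu tl≡u with <-cmp (rank u) (rank w)
  ... | tri< u<w _ _ = ⊥-elim (joins-≢ j (trans (sym tl≡u) (proj₁ (orient-rank (joins-sym j) ¬wu ¬uw u<w))))
  ... | tri≈ _ u≡w _ = ⊥-elim (rank-adj-≢ j u≡w)
  ... | tri> _ _ w<u = w<u

  orient-into-Y : ∀ {e z y} → z ∉ Y → z ≢ X₁ z → Joins G e z y → y ∈ Y → tl e ≡ z × hd e ≡ y
  orient-into-Y {z = z} {y} z∉Y z≢x₁ j y∈Y =
    orient-rank j (not-entrance-from-other {v = y} z≢x₁) (not-entrance-from-Y {w = z} y∈Y) (<-≤-trans (rank-Y< y∈Y) (rank-T≥ z∉Y))

  module Component {t : Fin n} (t∉Y : t ∉ Y) where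

    anc : IsAnchors (rep t) (anchorsAt (rep t))
    anc = anchors-ok t∉Y

    x₁ x₂ y₁ y₂ : Fin n
    x₁ = X₁ t
    x₂ = X₂ t
    y₁ = Y₁ t
    y₂ = Y₂ t

    x₁∉Y : x₁ ∉ Y
    x₁∉Y = X₁∉Y t∉Y

    x₂∉Y : x₂ ∉ Y
    x₂∉Y = X₂∉Y t∉Y

    y₁∈Y : y₁ ∈ Y
    y₁∈Y = Y₁∈Y t∉Y

    x₁≢x₂' : x₁ ≢ x₂
    x₁≢x₂' = x₁≢x₂ anc

    x₁-anchor : x₁ ≡ X₁ x₁
    x₁-anchor = sym (X₁-cong (rep-X₁ t∉Y))

    x₂-anchor : x₂ ≡ X₂ x₂
    x₂-anchor = sym (X₂-cong (rep-X₂ t∉Y))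

    x₂-not-x₁ : x₂ ≢ X₁ x₂
    x₂-not-x₁ x₂≡ = x₁≢x₂' (sym (trans x₂≡ (X₁-cong (rep-X₂ t∉Y))))

    rank-x₂' : rank x₂ ≡ n + K
    rank-x₂' = rank-x₂ x₂∉Y x₂-not-x₁ x₂-anchor

    rep-nbr₁ : ∀ {z} → z ∉ Y → Adj G x₁ z → rep z ≡ rep t
    rep-nbr₁ z∉Y a = trans (sym (rep-adj x₁∉Y z∉Y a)) (rep-X₁ t∉Y)

    rep-nbr₂ : ∀ {z} → z ∉ Y → Adj G x₂ z → rep z ≡ rep t
    rep-nbr₂ z∉Y a = trans (sym (rep-adj x₂∉Y z∉Y a)) (rep-X₂ t∉Y)

    entrance-edge : Fin m
    entrance-edge = entrance anc

    entrance-edge-joins : Joins G entrance-edge x₁ y₁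
    entrance-edge-joins = entrance-joins anc

    only-nbrY₁ : ∀ {w} → w ∈ Y → Adj G x₁ w → w ≡ y₁
    only-nbrY₁ w∈Y a = Equivalence.to (nbhdY₁ anc _) (w∈Y , a)

    in-T : ∀ {w} → Conn x₁ w → InComp G Y (rep t) w
    in-T r = conn⇒Walk (conn-trans (Walk⇒conn (x₁∈T anc)) r)

    x₁~x₂ : Adj G x₁ x₂
    x₁~x₂ with proj₂ (Equivalence.to (twins anc x₁) (x₁∈T anc , inj₁ refl))
    ... | inj₁ x₁≡x₂ = ⊥-elim (x₁≢x₂' x₁≡x₂)
    ... | inj₂ a = adj-sym a

    twin₁₂ : ∀ {w} → Adj G x₁ w → w ∉ Y → w ≢ x₂ → Adj G x₂ w
    twin₁₂ {w} a w∉Y w≢x₂ with proj₂ (Equivalence.to (twins anc w) (in-T (conn-adj x₁∉Y w∉Y a) , inj₂ a))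
    ... | inj₁ w≡x₂ = ⊥-elim (w≢x₂ w≡x₂)
    ... | inj₂ a' = a'

    twin₂₁ : ∀ {w} → Adj G x₂ w → w ∉ Y → w ≢ x₁ → Adj G x₁ w
    twin₂₁ {w} a w∉Y w≢x₁
      with proj₂ (Equivalence.from (twins anc w) (in-T (conn-trans (conn-adj x₁∉Y x₂∉Y x₁~x₂) (conn-adj x₂∉Y w∉Y a)) , inj₂ a))
    ... | inj₁ w≡x₁ = ⊥-elim (w≢x₁ w≡x₁)
    ... | inj₂ a' = a'

    orient-entrance-edge : ∀ {e} → Joins G e x₁ y₁ → tl e ≡ y₁ × hd e ≡ x₁
    orient-entrance-edge j = orient-entrance j entrance-x₁y₁
      where
      entrance-x₁y₁ : Entrance x₁ y₁ ≡ true
      entrance-x₁y₁ rewrite outY-complete x₁∉Y | dec-true (x₁ ≟ X₁ x₁) x₁-anchor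
                          | dec-true (y₁ ≟ Y₁ x₁) (sym (cong (λ L → Anchors.y₁ (anchorsAt L)) (rep-X₁ t∉Y))) = refl

    orient-from-x₁ : ∀ {e z} → Joins G e x₁ z → z ∉ Y → tl e ≡ x₁ × hd e ≡ z
    orient-from-x₁ {e} {z} j z∉Y =
      orient-rank j (not-entrance-into-T {x₁} z∉Y) (not-entrance-into-T {z} x₁∉Y)
        (subst (rank z <_) (sym (rank-x₁ x₁∉Y x₁-anchor))
          (rank-not-x₁< z∉Y (λ z≡ → joins-≢ j (sym (trans z≡ (X₁-cong (rep-nbr₁ z∉Y (joins-adj j))))))))

    orient-from-x₂ : ∀ {e z} → Joins G e x₂ z → z ∉ Y → z ≢ x₁ → tl e ≡ x₂ × hd e ≡ z
    orient-from-x₂ {e} {z} j z∉Y z≢x₁ =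
      orient-rank j (not-entrance-into-T {x₂} z∉Y) (not-entrance-into-T {z} x₂∉Y)
        (subst (rank z <_) (sym rank-x₂')
          (rank-other< z∉Y (λ z≡ → z≢x₁ (trans z≡ (X₁-cong (rep-nbr₂ z∉Y (joins-adj j)))))
                           (λ z≡ → joins-≢ j (sym (trans z≡ (X₂-cong (rep-nbr₂ z∉Y (joins-adj j))))))))

    into-x₁ : ∀ {e} → hd e ≡ x₁ → e ≡ entrance-edge
    into-x₁ {e} hd≡x₁ = by-side (tl e ∈? Y)
      where
      j : Joins G e x₁ (tl e)
      j = joins-sym (subst (Joins G e (tl e)) hd≡x₁ (tl-joins e))
      by-side : Dec (tl e ∈ Y) → e ≡ entrance-edge
      by-side (yes tl∈Y) = edge-unique (subst (Joins G e x₁) (only-nbrY₁ tl∈Y (joins-adj j)) j) entrance-edge-joins x₁∉Y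
      by-side (no tl∉Y) = ⊥-elim (joins-≢ j (sym (proj₁ (orient-from-x₁ j tl∉Y))))

    into-x₂ : ∀ {e} → hd e ≡ x₂ → Joins G e x₁ x₂
    into-x₂ {e} hd≡x₂ = by-side (tl e ∈? Y)
      where
      j : Joins G e x₂ (tl e)
      j = joins-sym (subst (Joins G e (tl e)) hd≡x₂ (tl-joins e))
      by-side : Dec (tl e ∈ Y) → Joins G e x₁ x₂
      by-side (yes tl∈Y) = ⊥-elim (∈-∉-≢ tl∈Y x₂∉Y (proj₁ (orient-into-Y x₂∉Y x₂-not-x₁ j tl∈Y)))
      by-side (no tl∉Y) with tl e ≟ x₁
      ... | yes tl≡x₁ = joins-sym (subst (Joins G e x₂) tl≡x₁ j)
      ... | no tl≢x₁ = ⊥-elim (joins-≢ j (sym (proj₁ (orient-from-x₂ j tl∉Y tl≢x₁))))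

    out-of-x₁ : ∀ {e} → tl e ≡ x₁ → (hd e ≡ x₂) ⊎ (hd e ∉ Y × hd e ≢ x₂)
    out-of-x₁ {e} tl≡x₁ = by-side (hd e ∈? Y)
      where
      j : Joins G e x₁ (hd e)
      j = subst (λ z → Joins G e z (hd e)) tl≡x₁ (tl-joins e)
      by-side : Dec (hd e ∈ Y) → (hd e ≡ x₂) ⊎ (hd e ∉ Y × hd e ≢ x₂)
      by-side (yes hd∈Y) =
        ⊥-elim (∈-∉-≢ y₁∈Y x₁∉Y (trans (sym (proj₁ (orient-entrance-edge (subst (Joins G e x₁) (only-nbrY₁ hd∈Y (joins-adj j)) j)))) tl≡x₁))
      by-side (no hd∉Y) with hd e ≟ x₂
      ... | yes hd≡x₂ = inj₁ hd≡x₂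
      ... | no hd≢x₂ = inj₂ (hd∉Y , hd≢x₂)

    out-of-x₂ : ∀ {e} → tl e ≡ x₂ → (hd e ∈ Y × TwoExits t ≡ true × hd e ≡ y₂) ⊎ (hd e ∉ Y × hd e ≢ x₁)
    out-of-x₂ {e} tl≡x₂ = by-side (hd e ∈? Y)
      where
      j : Joins G e x₂ (hd e)
      j = subst (λ z → Joins G e z (hd e)) tl≡x₂ (tl-joins e)
      by-side : Dec (hd e ∈ Y) → (hd e ∈ Y × TwoExits t ≡ true × hd e ≡ y₂) ⊎ (hd e ∉ Y × hd e ≢ x₁)
      by-side (yes hd∈Y) with nbhdY₂ anc
      ... | inj₁ (two , N₂ , _) = inj₁ (hd∈Y , two , Equivalence.to (N₂ _) (hd∈Y , joins-adj j))
      ... | inj₂ (_ , noY₂) = ⊥-elim (noY₂ _ hd∈Y (joins-adj j))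
      by-side (no hd∉Y) with hd e ≟ x₁
      ... | yes hd≡x₁ = ⊥-elim (x₁≢x₂' (trans (sym (proj₁ (orient-from-x₁ (joins-sym (subst (Joins G e x₂) hd≡x₁ j)) x₂∉Y))) tl≡x₂))
      ... | no hd≢x₁ = inj₂ (hd∉Y , hd≢x₁)

  tl-inc : ∀ e → Inc G e (tl e)
  tl-inc e with D e
  ... | true  = inj₁ refl
  ... | false = inj₂ refl

  out-of-Y : ∀ {v} → v ∈ Y → ∀ e → tl e ≡ v →
             (Inc G e v × (end₁ e ∈ Y) × (end₂ e ∈ Y)) ⊎ ((e ∈ F) × Inc G e v)
  out-of-Y {v} v∈Y e tl≡v = by-side (hd e ∈? Y)
    where
    j : Joins G e v (hd e)
    j = subst (λ z → Joins G e z (hd e)) tl≡v (tl-joins e)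
    both-in-Y : ∀ {u w} → Joins G e u w → u ∈ Y → w ∈ Y → (end₁ e ∈ Y) × (end₂ e ∈ Y)
    both-in-Y (inj₁ (p , q)) u∈Y w∈Y = subst (_∈ Y) (sym p) u∈Y , subst (_∈ Y) (sym q) w∈Y
    both-in-Y (inj₂ (p , q)) u∈Y w∈Y = subst (_∈ Y) (sym p) w∈Y , subst (_∈ Y) (sym q) u∈Y
    by-side : Dec (hd e ∈ Y) → (Inc G e v × (end₁ e ∈ Y) × (end₂ e ∈ Y)) ⊎ ((e ∈ F) × Inc G e v)
    by-side (yes hd∈Y) = inj₁ (joins-inc j , both-in-Y j v∈Y hd∈Y)
    by-side (no hd∉Y) with hd e ≟ X₁ (hd e)
    ... | yes hd≡x₁ = inj₂ (subst (_∈ F) (sym is-entrance) (entrance∈F anc) , joins-inc j)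
      where
      open Component hd∉Y
      is-entrance : e ≡ entrance-edge
      is-entrance = into-x₁ hd≡x₁
    ... | no hd≢x₁ = ⊥-elim (∈-∉-≢ v∈Y hd∉Y (trans (sym tl≡v) (proj₁ (orient-into-Y hd∉Y hd≢x₁ (joins-sym j) v∈Y))))

  in-arc : ∀ {v} → v ∉ Y → ∃ λ e → Inc G e v × tl e ≢ v
  in-arc {v} v∉Y = by-kind (v ≟ X₁ v) (v ≟ X₂ v)
    where
    open Component v∉Y
    by-kind : Dec (v ≡ X₁ v) → Dec (v ≡ X₂ v) → ∃ λ e → Inc G e v × tl e ≢ v
    by-kind (yes v≡x₁) _ =
      entrance-edge , subst (Inc G entrance-edge) (sym v≡x₁) (joins-inc entrance-edge-joins) ,
      λ tl≡v → ∈-∉-≢ y₁∈Y v∉Y (trans (sym (proj₁ (orient-entrance-edge entrance-edge-joins))) tl≡v)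
    by-kind (no v≢x₁) (yes v≡x₂) =
      proj₁ x₁~x₂ , subst (Inc G (proj₁ x₁~x₂)) (sym v≡x₂) (joins-inc (joins-sym (proj₂ x₁~x₂))) ,
      λ tl≡v → v≢x₁ (trans (sym tl≡v) (proj₁ (orient-from-x₁ (proj₂ x₁~x₂) x₂∉Y)))
    by-kind (no v≢x₁) (no v≢x₂) with closer-neighbour v∉Y v≢x₁
    ... | u , (e , j) , u∉Y , closer =
      e , joins-inc j ,
      λ tl≡v → joins-≢ j (trans (sym tl≡v)
        (proj₁ (orient-rank (joins-sym j) (not-entrance-into-T {u} v∉Y) (not-entrance-into-T {v} u∉Y)
                  (rank-closer u∉Y v∉Y v≢x₁ v≢x₂ closer))))

  -- the out-degree condition of f-AT: by (3) on Y and by (2) plus an in-arc outside Y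
  outdeg-bound : ∀ v → suc (outdeg G D v) ≤ f v
  outdeg-bound v with v ∈? Y
  ... | yes v∈Y =
    ≤-trans (s≤s (begin
      outdeg G D v                                          ≡⟨ countFin≡count G (λ e → tl e ≟ v) ⟩
      count (λ e → does (tl e ≟ v))                          ≤⟨ count-∪ _ _ _ G[Y]-or-F ⟩
      count (λ e → does (inY? e)) + count (λ e → does (inF? e))
        ≡⟨ sym (cong₂ _+_ (countFin≡count G inY?) (countFin≡count G inF?)) ⟩
      degInduced G Y v + degSub G F v                        ∎))
      (hyp3 v v∈Y)
    where
    open ≤-Reasoning
    inY? : ∀ e → Dec (Inc G e v × (end₁ e ∈ Y) × (end₂ e ∈ Y))
    inY? e = inc? G e v ×-dec ((end₁ e ∈? Y) ×-dec (end₂ e ∈? Y))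
    inF? : ∀ e → Dec ((e ∈ F) × Inc G e v)
    inF? e = (e ∈? F) ×-dec inc? G e v
    G[Y]-or-F : ∀ e → does (tl e ≟ v) ≡ true → (does (inY? e) ≡ true) ⊎ (does (inF? e) ≡ true)
    G[Y]-or-F e out with out-of-Y v∈Y e (dec-sound (tl e ≟ v) out)
    ... | inj₁ inY = inj₁ (dec-true (inY? e) inY)
    ... | inj₂ inF = inj₂ (dec-true (inF? e) inF)
  ... | no v∉Y with in-arc v∉Y
  ... | e , e∋v , tl≢v =
    ≤-trans (begin-strict
      outdeg G D v                    ≡⟨ countFin≡count G (λ e → tl e ≟ v) ⟩
      count (λ e → does (tl e ≟ v))  <⟨ count-strict _ _ out⊆inc e (dec-true (inc? G e v) e∋v) (dec-false (tl e ≟ v) tl≢v) ⟩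
      count (λ e → does (inc? G e v)) ≡⟨ sym (countFin≡count G (λ e → inc? G e v)) ⟩
      deg G v                         ∎)
      (hyp2 v v∉Y)
    where
    open ≤-Reasoning
    out⊆inc : ∀ e → does (tl e ≟ v) ≡ true → does (inc? G e v) ≡ true
    out⊆inc e out = dec-true (inc? G e v) (subst (Inc G e) (dec-sound (tl e ≟ v) out) (tl-inc e))

  -- Spanning subgraphs of D, given by the Boolean vector h of their arcs.

  In Out : (Fin m → Bool) → Fin n → ℕ
  In  h v = count (λ e → h e ∧ does (hd e ≟ v))
  Out h v = count (λ e → h e ∧ does (tl e ≟ v))

  Balanced : (Fin m → Bool) → Set
  Balanced h = ∀ v → In h v ≡ Out h v

  Balanced-ext : ∀ h h' → (∀ e → h e ≡ h' e) → Balanced h → Balanced h'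
  Balanced-ext h h' h≗h' bal v =
    trans (count-ext _ _ (λ e → cong (_∧ does (hd e ≟ v)) (sym (h≗h' e))))
          (trans (bal v) (count-ext _ _ (λ e → cong (_∧ does (tl e ≟ v)) (h≗h' e))))

  in-witness : ∀ h v → 1 ≤ In h v → ∃ λ e → h e ≡ true × hd e ≡ v
  in-witness h v pos =
    let (e , he) = count-witness (λ e → h e ∧ does (hd e ≟ v)) pos
    in e , ∧-proj₁ he , dec-sound (hd e ≟ v) (∧-proj₂ {h e} he)

  out-witness : ∀ h v → 1 ≤ Out h v → ∃ λ e → h e ≡ true × tl e ≡ v
  out-witness h v pos =
    let (e , he) = count-witness (λ e → h e ∧ does (tl e ≟ v)) pos
    in e , ∧-proj₁ he , dec-sound (tl e ≟ v) (∧-proj₂ {h e} he)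

  in-pos : ∀ h v e → h e ≡ true → hd e ≡ v → 1 ≤ In h v
  in-pos h v e he hd≡v = count-pos _ e (∧-intro he (dec-true (hd e ≟ v) hd≡v))

  out-pos : ∀ h v e → h e ≡ true → tl e ≡ v → 1 ≤ Out h v
  out-pos h v e he tl≡v = count-pos _ e (∧-intro he (dec-true (tl e ≟ v) tl≡v))

  in-zero : ∀ h v → (∀ e → hd e ≡ v → h e ≡ false) → In h v ≡ 0
  in-zero h v unused = count-zero _ not-in
    where
    not-in : ∀ e → (h e ∧ does (hd e ≟ v)) ≡ false
    not-in e with hd e ≟ v
    ... | yes hd≡v = trans (∧-identityʳ (h e)) (unused e hd≡v)
    ... | no _ = ∧-zeroʳ (h e)

  out≥2 : ∀ h v e e' → h e ≡ true → h e' ≡ true → tl e ≡ v → tl e' ≡ v → e ≢ e' → 2 ≤ Out h v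
  out≥2 h v e e' he he' tl≡v tl'≡v e≢e' =
    count-≥2 _ e e' (∧-intro he (dec-true (tl e ≟ v) tl≡v)) (∧-intro he' (dec-true (tl e' ≟ v) tl'≡v)) e≢e'

  in-x₁≤1 : ∀ h {t} (t∉Y : t ∉ Y) → In h (X₁ t) ≤ 1
  in-x₁≤1 h t∉Y = count-≤1 _ (Component.entrance-edge t∉Y)
    (λ e p → Component.into-x₁ t∉Y (dec-sound (hd e ≟ _) (∧-proj₂ {h e} p)))

  in-x₂≤1 : ∀ h {t} (t∉Y : t ∉ Y) → In h (X₂ t) ≤ 1
  in-x₂≤1 h t∉Y = count-≤1 _ (proj₁ x₁~x₂)
    (λ e p → edge-unique (into-x₂ (dec-sound (hd e ≟ _) (∧-proj₂ {h e} p))) (proj₂ x₁~x₂) x₁∉Y)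
    where open Component t∉Y

  -- so in a balanced subgraph they cannot have two outgoing arcs
  ≤1-≥2 : ∀ {a b} → a ≡ b → a ≤ 1 → 2 ≤ b → ⊥
  ≤1-≥2 refl (s≤s z≤n) (s≤s ())
  ≤1-≥2 refl z≤n ()

  -- Switch arcs.  An arc a = x₁ → w with w ∈ T - x₂ has the detour
  -- b = x₁ → x₂, c = x₂ → w (x₂ is a twin of x₁); switching exchanges
  -- a against b, c.

  IsSwitchArc : Fin m → Bool
  IsSwitchArc a = outY (tl a) ∧ isX₁ (tl a) ∧ not (does (hd a ≟ X₂ (tl a))) ∧ outY (hd a)

  detour₁ detour₂ : Fin m → Fin m
  detour₁ a = edge-between a (tl a) (X₂ (tl a))
  detour₂ a = edge-between a (X₂ (tl a)) (hd a)

  record SwitchArc (a : Fin m) : Set where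
    field
      tail∉Y : tl a ∉ Y
      tail-x₁ : tl a ≡ X₁ (tl a)
      head≢x₂ : hd a ≢ X₂ (tl a)
      tail≢x₂ : tl a ≢ X₂ (tl a)
      rep-x₂ : rep (X₂ (tl a)) ≡ rep (tl a)
      joins-b : Joins G (detour₁ a) (tl a) (X₂ (tl a))
      joins-c : Joins G (detour₂ a) (X₂ (tl a)) (hd a)
      tl-b : tl (detour₁ a) ≡ tl a
      hd-b : hd (detour₁ a) ≡ X₂ (tl a)
      tl-c : tl (detour₂ a) ≡ X₂ (tl a)
      hd-c : hd (detour₂ a) ≡ hd a

    a≢b : a ≢ detour₁ a
    a≢b a≡b = head≢x₂ (trans (cong hd a≡b) hd-b)

    a≢c : a ≢ detour₂ a
    a≢c a≡c = tail≢x₂ (trans (cong tl a≡c) tl-c)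

    b≢c : detour₁ a ≢ detour₂ a
    b≢c b≡c = tail≢x₂ (trans (sym tl-b) (trans (cong tl b≡c) tl-c))

  -- a switch arc has a detour: x₁ ~ x₂, and x₂ ~ w because x₂ is a twin of x₁
  switch-arc : ∀ a → IsSwitchArc a ≡ true → SwitchArc a
  switch-arc a isA = record
    { tail∉Y = tl∉Y ; tail-x₁ = tl≡x₁ ; head≢x₂ = hd≢x₂ ; tail≢x₂ = λ q → x₁≢x₂' (trans (sym tl≡x₁) q)
    ; rep-x₂ = rep-X₂ tl∉Y ; joins-b = joins-b ; joins-c = joins-c
    ; tl-b = trans (proj₁ b-orient) (sym tl≡x₁) ; hd-b = proj₂ b-orient
    ; tl-c = proj₁ c-orient ; hd-c = proj₂ c-orient }
    where
    tl∉Y : tl a ∉ Y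
    tl∉Y = outY-sound (∧-proj₁ isA)
    open Component tl∉Y
    tl≡x₁ : tl a ≡ X₁ (tl a)
    tl≡x₁ = dec-sound (tl a ≟ X₁ (tl a)) (∧-proj₁ (∧-proj₂ {outY (tl a)} isA))
    hd≢x₂ : hd a ≢ X₂ (tl a)
    hd≢x₂ hd≡x₂ with trans (sym (cong not (dec-true (hd a ≟ X₂ (tl a)) hd≡x₂)))
                           (∧-proj₁ (∧-proj₂ {isX₁ (tl a)} (∧-proj₂ {outY (tl a)} isA)))
    ... | ()
    hd∉Y : hd a ∉ Y
    hd∉Y = outY-sound (∧-proj₂ {not (does (hd a ≟ X₂ (tl a)))} (∧-proj₂ {isX₁ (tl a)} (∧-proj₂ {outY (tl a)} isA)))
    j : Joins G a x₁ (hd a)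
    j = subst (λ z → Joins G a z (hd a)) tl≡x₁ (tl-joins a)
    joins-b : Joins G (detour₁ a) (tl a) (X₂ (tl a))
    joins-b = edge-between-joins (subst (λ z → Adj G z x₂) (sym tl≡x₁) x₁~x₂) a
    joins-c : Joins G (detour₂ a) (X₂ (tl a)) (hd a)
    joins-c = edge-between-joins (twin₁₂ (joins-adj j) hd∉Y hd≢x₂) a
    b-orient : tl (detour₁ a) ≡ x₁ × hd (detour₁ a) ≡ x₂
    b-orient = orient-from-x₁ (subst (λ z → Joins G (detour₁ a) z x₂) tl≡x₁ joins-b) x₂∉Y
    c-orient : tl (detour₂ a) ≡ x₂ × hd (detour₂ a) ≡ hd a
    c-orient = orient-from-x₂ joins-c hd∉Y (λ hd≡x₁ → joins-≢ j (sym hd≡x₁))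

  switch : (Fin m → Bool) → Fin m → Fin m → Bool
  switch h a = toggle3 h a (detour₁ a) (detour₂ a)

  switchableAt : (Fin m → Bool) → Fin m → Bool
  switchableAt h a = IsSwitchArc a ∧ switchable (h a) (h (detour₁ a)) (h (detour₂ a))

  switchableAt-sound : ∀ h a → switchableAt h a ≡ true →
                       IsSwitchArc a ≡ true × Switchable (h a) (h (detour₁ a)) (h (detour₂ a))
  switchableAt-sound h a p = ∧-proj₁ p , switchable-sound _ _ _ (∧-proj₂ {IsSwitchArc a} p)

  switch-balanced : ∀ h a → Balanced h → SwitchArc a → Switchable (h a) (h (detour₁ a)) (h (detour₂ a)) →
                    Balanced (switch h a)
  switch-balanced h a bal sa sw v =
    switch-balance (In (switch h a) v) (In h v) (Out (switch h a) v) (Out h v)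
      (at-head a) (at-head (detour₁ a)) (at-head (detour₂ a)) (at-tail a) (at-tail (detour₁ a)) (at-tail (detour₂ a)) sw
      (cong (λ z → does (z ≟ v)) hd-c) (cong (λ z → does (z ≟ v)) tl-b) (cong (λ z → does (z ≟ v)) (trans tl-c (sym hd-b)))
      (bal v) (count-toggle3 at-head) (count-toggle3 at-tail)
    where
    open SwitchArc sa
    open Toggle3 h a (detour₁ a) (detour₂ a) a≢b a≢c b≢c
    at-head at-tail : Fin m → Bool
    at-head e = does (hd e ≟ v)
    at-tail e = does (tl e ≟ v)

  switchable-unique : ∀ h a a' → Balanced h → switchableAt h a ≡ true → switchableAt h a' ≡ true →
                      rep (tl a) ≡ rep (tl a') → a ≡ a'
  switchable-unique h a a' bal sw sw' same with a ≟ a'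
  ... | yes a≡a' = a≡a'
  ... | no a≢a' = ⊥-elim (both (proj₂ (switchableAt-sound h a sw)) (proj₂ (switchableAt-sound h a' sw')))
    where
    sa : SwitchArc a
    sa = switch-arc a (proj₁ (switchableAt-sound h a sw))
    sa' : SwitchArc a'
    sa' = switch-arc a' (proj₁ (switchableAt-sound h a' sw'))
    module S = SwitchArc sa
    module S' = SwitchArc sa'
    same-tail : tl a ≡ tl a'
    same-tail = trans S.tail-x₁ (trans (X₁-cong same) (sym S'.tail-x₁))
    same-b : detour₁ a ≡ detour₁ a'
    same-b = edge-unique S.joins-b (subst (λ z → Joins G (detour₁ a') z (X₂ z)) (sym same-tail) S'.joins-b) S.tail∉Y
    different-c : detour₂ a ≢ detour₂ a'
    different-c c≡c' =
      a≢a' (edge-unique (tl-joins a)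
              (subst₂ (Joins G a') (sym same-tail) (trans (sym S'.hd-c) (trans (cong hd (sym c≡c')) S.hd-c)) (tl-joins a'))
              S.tail∉Y)
    -- two arcs a, a' out of x₁, or two arcs c, c' out of x₂, or b both used and unused
    both : Switchable (h a) (h (detour₁ a)) (h (detour₂ a)) → Switchable (h a') (h (detour₁ a')) (h (detour₂ a')) → ⊥
    both (inj₁ (ha , _ , _)) (inj₁ (ha' , _ , _)) =
      ≤1-≥2 (bal (X₁ (tl a))) (in-x₁≤1 h S.tail∉Y) (out≥2 h _ a a' ha ha' S.tail-x₁ (trans (sym same-tail) S.tail-x₁) a≢a')
    both (inj₁ (_ , hb , _)) (inj₂ (_ , hb' , _)) with trans (sym hb') (trans (cong h (sym same-b)) hb)
    ... | ()
    both (inj₂ (_ , hb , _)) (inj₁ (_ , hb' , _)) with trans (sym hb) (trans (cong h same-b) hb')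
    ... | ()
    both (inj₂ (_ , _ , hc)) (inj₂ (_ , _ , hc')) =
      ≤1-≥2 (bal (X₂ (tl a))) (in-x₂≤1 h S.tail∉Y)
        (out≥2 h _ (detour₂ a) (detour₂ a') hc hc' S.tl-c (trans S'.tl-c (cong X₂ (sym same-tail))) different-c)

  -- A balanced subgraph without switchable arc is empty: all its arcs
  -- strictly decrease the potential below.

  NoSwitch : (Fin m → Bool) → Set
  NoSwitch h = ∀ a → switchableAt h a ≡ false

  into-x₂-detour : ∀ {a} (sa : SwitchArc a) e → hd e ≡ X₂ (tl a) → e ≡ detour₁ a
  into-x₂-detour {a} sa e hd≡x₂ =
    edge-unique (subst (λ z → Joins G e z (X₂ (tl a))) (sym tail-x₁) (Component.into-x₂ tail∉Y hd≡x₂)) joins-b tail∉Y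
    where open SwitchArc sa

  switch-arc-unused : ∀ h → Balanced h → NoSwitch h → ∀ a → IsSwitchArc a ≡ true → h a ≡ false
  switch-arc-unused h bal noSwitch a isA = not-true (h a) used
    where
    sa : SwitchArc a
    sa = switch-arc a isA
    open SwitchArc sa
    used : h a ≡ true → ⊥
    used ha with unswitchable-arc (h (detour₁ a)) (h (detour₂ a))
                   (trans (sym (cong₂ (λ i x → i ∧ switchable x (h (detour₁ a)) (h (detour₂ a))) isA ha)) (noSwitch a))
    -- x₁ would have two outgoing arcs
    ... | inj₁ hb = ≤1-≥2 (bal (tl a)) (subst (λ z → In h z ≤ 1) (sym tail-x₁) (in-x₁≤1 h tail∉Y))
                     (out≥2 h (tl a) a (detour₁ a) ha hb refl tl-b a≢b)
    -- x₂ would have an outgoing but no incoming arc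
    ... | inj₂ (hb , hc) =
      n≮0 (subst (1 ≤_) (in-zero h _ (λ e hd≡x₂ → trans (cong h (into-x₂-detour sa e hd≡x₂)) hb))
                 (subst (1 ≤_) (sym (bal (X₂ (tl a)))) (out-pos h _ (detour₂ a) hc tl-c)))

  -- without switches, no arc x₂ → w with w ∈ T - x₁ is used (x₁ → w would be switchable)
  x₂-arc-unused : ∀ h → Balanced h → NoSwitch h → ∀ {t} (t∉Y : t ∉ Y) e → h e ≡ true →
                  tl e ≡ X₂ t → hd e ∉ Y → hd e ≢ X₁ t → ⊥
  x₂-arc-unused h bal noSwitch {t} t∉Y e he tl≡x₂ w∉Y w≢x₁ =
    true≢false (trans (sym ha₀) (switch-arc-unused h bal noSwitch a₀ isA₀))
    where
    open Component t∉Y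
    w : Fin n
    w = hd e
    j : Joins G e x₂ w
    j = subst (λ z → Joins G e z w) tl≡x₂ (tl-joins e)
    x₁~w : Adj G x₁ w
    x₁~w = twin₂₁ (joins-adj j) w∉Y w≢x₁
    a₀ : Fin m
    a₀ = proj₁ x₁~w
    a₀-orient : tl a₀ ≡ x₁ × hd a₀ ≡ w
    a₀-orient = orient-from-x₁ (proj₂ x₁~w) w∉Y
    tl-a₀ : tl a₀ ≡ x₁
    tl-a₀ = proj₁ a₀-orient
    hd-a₀ : hd a₀ ≡ w
    hd-a₀ = proj₂ a₀-orient
    x₂-of-a₀ : X₂ (tl a₀) ≡ x₂
    x₂-of-a₀ = trans (cong X₂ tl-a₀) (X₂-cong (rep-X₁ t∉Y))
    isA₀ : IsSwitchArc a₀ ≡ true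
    isA₀ = ∧-intro (outY-complete (subst (_∉ Y) (sym tl-a₀) x₁∉Y))
             (∧-intro (dec-true (tl a₀ ≟ X₁ (tl a₀)) (trans tl-a₀ (trans x₁-anchor (cong X₁ (sym tl-a₀)))))
               (∧-intro (cong not (dec-false (hd a₀ ≟ X₂ (tl a₀)) (λ q → joins-≢ j (sym (trans (sym hd-a₀) (trans q x₂-of-a₀))))))
                 (outY-complete (subst (_∉ Y) (sym hd-a₀) w∉Y))))
    sa₀ : SwitchArc a₀
    sa₀ = switch-arc a₀ isA₀
    c≡e : detour₂ a₀ ≡ e
    c≡e = edge-unique (subst₂ (Joins G (detour₂ a₀)) x₂-of-a₀ hd-a₀ (SwitchArc.joins-c sa₀)) j x₂∉Y
    hc₀ : h (detour₂ a₀) ≡ true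
    hc₀ = trans (cong h c≡e) he
    -- x₂ has an outgoing arc, so its only possible incoming arc b is used
    hb₀ : h (detour₁ a₀) ≡ true
    hb₀ = let (e' , he' , hd≡x₂) = in-witness h (X₂ (tl a₀))
                                     (subst (1 ≤_) (sym (bal (X₂ (tl a₀)))) (out-pos h (X₂ (tl a₀)) e he (trans tl≡x₂ (sym x₂-of-a₀))))
          in trans (cong h (sym (into-x₂-detour sa₀ e' hd≡x₂))) he'
    ha₀ : h a₀ ≡ true
    ha₀ = unswitchable-detour (h a₀) (trans (sym (cong₃ (λ i y z → i ∧ switchable (h a₀) y z) isA₀ hb₀ hc₀)) (noSwitch a₀))

  x₁x₂-used⇒two-exits : ∀ h → Balanced h → NoSwitch h → ∀ {t} (t∉Y : t ∉ Y) e → h e ≡ true → hd e ≡ X₂ t →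
                        TwoExits t ≡ true
  x₁x₂-used⇒two-exits h bal noSwitch {t} t∉Y e he hd≡x₂ = by-out-arc (Component.out-of-x₂ t∉Y tl-e')
    where
    -- x₂ is entered by e, so it has an outgoing arc e'
    e'-out : ∃ λ e' → h e' ≡ true × tl e' ≡ X₂ t
    e'-out = out-witness h (X₂ t) (subst (1 ≤_) (bal (X₂ t)) (in-pos h (X₂ t) e he hd≡x₂))
    e' : Fin m
    e' = proj₁ e'-out
    tl-e' : tl e' ≡ X₂ t
    tl-e' = proj₂ (proj₂ e'-out)
    by-out-arc : (hd e' ∈ Y × TwoExits t ≡ true × hd e' ≡ Y₂ t) ⊎ (hd e' ∉ Y × hd e' ≢ X₁ t) → TwoExits t ≡ true
    by-out-arc (inj₁ (_ , two , _)) = two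
    by-out-arc (inj₂ (w∉Y , w≢x₁)) = ⊥-elim (x₂-arc-unused h bal noSwitch t∉Y e' (proj₁ (proj₂ e'-out)) tl-e' w∉Y w≢x₁)

  -- The potential interleaves Y (3y + 2, by index) with the anchors: x₁ sits
  -- just below its y₁, x₂ just above its y₂; all other vertices of G - Y lie
  -- above everything, ordered by rank.
  abstract
    potential : Fin n → ℕ
    potential z =
      if outY z then (if isX₁ z then 3 * toℕ (Y₁ z) + 1 else if isX₂ z then 3 * toℕ (Y₂ z) + 3 else 3 * n + rank z)
      else 3 * toℕ z + 2

    potential-Y : ∀ {z} → z ∈ Y → potential z ≡ 3 * toℕ z + 2
    potential-Y z∈Y rewrite outY-false z∈Y = refl

    potential-x₁ : ∀ {z} → z ∉ Y → z ≡ X₁ z → potential z ≡ 3 * toℕ (Y₁ z) + 1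
    potential-x₁ {z} z∉Y z≡x₁ rewrite outY-complete z∉Y | dec-true (z ≟ X₁ z) z≡x₁ = refl

    potential-x₂ : ∀ {z} → z ∉ Y → z ≢ X₁ z → z ≡ X₂ z → potential z ≡ 3 * toℕ (Y₂ z) + 3
    potential-x₂ {z} z∉Y z≢x₁ z≡x₂ rewrite outY-complete z∉Y | dec-false (z ≟ X₁ z) z≢x₁ | dec-true (z ≟ X₂ z) z≡x₂ = refl

    potential-other : ∀ {z} → z ∉ Y → z ≢ X₁ z → z ≢ X₂ z → potential z ≡ 3 * n + rank z
    potential-other {z} z∉Y z≢x₁ z≢x₂ rewrite outY-complete z∉Y | dec-false (z ≟ X₁ z) z≢x₁ | dec-false (z ≟ X₂ z) z≢x₂ = refl

  3a+3≤3b : ∀ {a b} → a < b → 3 * a + 3 ≤ 3 * b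
  3a+3≤3b {a} {b} a<b = begin
    3 * a + 3 ≡⟨ trans (+-comm (3 * a) 3) (sym (*-suc 3 a)) ⟩
    3 * suc a ≤⟨ *-monoʳ-≤ 3 a<b ⟩
    3 * b     ∎
    where open ≤-Reasoning

  Ordinary : Fin n → Set
  Ordinary u = (u ∈ Y) ⊎ (u ∉ Y × u ≢ X₁ u × u ≢ X₂ u)

  descends-into-Y : ∀ e → Ordinary (tl e) → hd e ∈ Y → potential (hd e) < potential (tl e)
  descends-into-Y e (inj₁ u∈Y) w∈Y =
    subst₂ _<_ (sym (potential-Y w∈Y)) (sym (potential-Y u∈Y))
      (+-monoˡ-< 2 (*-monoʳ-< 3 (subst₂ _<_ (rank-Y w∈Y) (rank-Y u∈Y)
        (tail-rank (tl-joins e) (not-entrance-from-Y {w = hd e} u∈Y) (not-entrance-from-Y {w = tl e} w∈Y) refl))))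
  descends-into-Y e (inj₂ (u∉Y , u≢x₁ , u≢x₂)) w∈Y =
    subst₂ _<_ (sym (potential-Y w∈Y)) (sym (potential-other u∉Y u≢x₁ u≢x₂))
      (≤-trans (≤-reflexive (sym (+-suc (3 * toℕ (hd e)) 2)))
               (≤-trans (3a+3≤3b (toℕ<n (hd e))) (m≤m+n (3 * n) (rank (tl e)))))

  descends-into-T : ∀ e → Ordinary (tl e) → hd e ∉ Y → potential (hd e) < potential (tl e)
  descends-into-T e ord w∉Y = by-kind (w ≟ X₁ w) (w ≟ X₂ w)
    where
    u w : Fin n
    u = tl e
    w = hd e
    open Component w∉Y
    by-kind : Dec (w ≡ X₁ w) → Dec (w ≡ X₂ w) → potential w < potential u
    -- an arc into x₁ is the entrance arc from y₁
    by-kind (yes w≡x₁) _ =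
      subst₂ _<_ (sym (potential-x₁ w∉Y w≡x₁)) (sym (potential-Y (subst (_∈ Y) (sym u≡y₁) y₁∈Y)))
        (subst (λ z → 3 * toℕ (Y₁ w) + 1 < 3 * toℕ z + 2) (sym u≡y₁) (+-monoʳ-< (3 * toℕ (Y₁ w)) ≤-refl))
      where
      u≡y₁ : u ≡ Y₁ w
      u≡y₁ = trans (cong tl (into-x₁ w≡x₁)) (proj₁ (orient-entrance-edge entrance-edge-joins))
    -- an arc into x₂ comes from x₁, which is not ordinary
    by-kind (no w≢x₁) (yes w≡x₂) = ⊥-elim (x₁-not-ordinary ord)
      where
      u≡x₁ : u ≡ X₁ w
      u≡x₁ = proj₁ (orient-from-x₁ (into-x₂ w≡x₂) x₂∉Y)
      x₁-not-ordinary : Ordinary u → ⊥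
      x₁-not-ordinary (inj₁ u∈Y) = x₁∉Y (subst (_∈ Y) u≡x₁ u∈Y)
      x₁-not-ordinary (inj₂ (_ , u≢x₁ , _)) = u≢x₁ (trans u≡x₁ (trans x₁-anchor (cong X₁ (sym u≡x₁))))
    -- between ordinary vertices the arc follows the rank (and cannot come from Y)
    by-kind (no w≢x₁) (no w≢x₂) = between-ordinary ord
      where
      between-ordinary : Ordinary u → potential w < potential u
      between-ordinary (inj₁ u∈Y) =
        ⊥-elim (<-irrefl refl (<-trans (tail-rank (tl-joins e) (not-entrance-from-Y {w = w} u∈Y) (not-entrance-from-other {v = u} w≢x₁) refl)
                                       (<-≤-trans (rank-Y< u∈Y) (rank-T≥ w∉Y))))
      between-ordinary (inj₂ (u∉Y , u≢x₁ , u≢x₂)) =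
        subst₂ _<_ (sym (potential-other w∉Y w≢x₁ w≢x₂)) (sym (potential-other u∉Y u≢x₁ u≢x₂))
          (+-monoʳ-< (3 * n) (tail-rank (tl-joins e) (not-entrance-into-T {u} w∉Y) (not-entrance-into-T {w} u∉Y) refl))

  descends-from-ordinary : ∀ e → Ordinary (tl e) → potential (hd e) < potential (tl e)
  descends-from-ordinary e ord with hd e ∈? Y
  ... | yes w∈Y = descends-into-Y e ord w∈Y
  ... | no w∉Y  = descends-into-T e ord w∉Y

  -- without switches, a used arc out of x₁ goes to x₂, in case (a), where y₂ < y₁
  descends-from-x₁ : ∀ h → Balanced h → NoSwitch h → ∀ e → h e ≡ true → (u∉Y : tl e ∉ Y) → tl e ≡ X₁ (tl e) →
                     potential (hd e) < potential (tl e)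
  descends-from-x₁ h bal noSwitch e he u∉Y u≡x₁ = by-head (out-of-x₁ u≡x₁)
    where
    u w : Fin n
    u = tl e
    w = hd e
    open Component u∉Y
    by-head : (w ≡ x₂) ⊎ (w ∉ Y × w ≢ x₂) → potential w < potential u
    by-head (inj₁ w≡x₂) = by-case (nbhdY₂ anc)
      where
      two : TwoExits u ≡ true
      two = x₁x₂-used⇒two-exits h bal noSwitch u∉Y e he w≡x₂
      by-case : (TwoExits u ≡ true × NbhdInYIs G Y x₂ y₂ × toℕ y₂ < toℕ y₁) ⊎ (TwoExits u ≡ false × NoNbrInY G Y x₂) →
                potential w < potential u
      by-case (inj₁ (_ , _ , y₂<y₁)) =
        subst₂ _<_ (sym (trans (cong potential w≡x₂)
                              (trans (potential-x₂ x₂∉Y x₂-not-x₁ x₂-anchor)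
                                     (cong (λ z → 3 * toℕ z + 3) (cong (λ L → Anchors.y₂ (anchorsAt L)) (rep-X₂ u∉Y))))))
                   (sym (potential-x₁ u∉Y u≡x₁))
          (≤-trans (s≤s (3a+3≤3b y₂<y₁)) (≤-reflexive (+-comm 1 (3 * toℕ (Y₁ u)))))
      by-case (inj₂ (one , _)) = ⊥-elim (true≢false (trans (sym two) one))
    by-head (inj₂ (w∉Y , w≢x₂)) =
      ⊥-elim (true≢false (trans (sym he) (switch-arc-unused h bal noSwitch e
        (∧-intro (outY-complete u∉Y) (∧-intro (dec-true (u ≟ X₁ u) u≡x₁)
          (∧-intro (cong not (dec-false (w ≟ X₂ u) w≢x₂)) (outY-complete w∉Y)))))))

  -- without switches, a used arc out of x₂ goes to y₂
  descends-from-x₂ : ∀ h → Balanced h → NoSwitch h → ∀ e → h e ≡ true → (u∉Y : tl e ∉ Y) →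
                     tl e ≢ X₁ (tl e) → tl e ≡ X₂ (tl e) → potential (hd e) < potential (tl e)
  descends-from-x₂ h bal noSwitch e he u∉Y u≢x₁ u≡x₂ = by-head (Component.out-of-x₂ u∉Y u≡x₂)
    where
    by-head : (hd e ∈ Y × TwoExits (tl e) ≡ true × hd e ≡ Y₂ (tl e)) ⊎ (hd e ∉ Y × hd e ≢ X₁ (tl e)) →
              potential (hd e) < potential (tl e)
    by-head (inj₁ (w∈Y , _ , w≡y₂)) =
      subst₂ _<_ (sym (trans (potential-Y w∈Y) (cong (λ z → 3 * toℕ z + 2) w≡y₂))) (sym (potential-x₂ u∉Y u≢x₁ u≡x₂))
        (+-monoʳ-< (3 * toℕ (Y₂ (tl e))) ≤-refl)
    by-head (inj₂ (w∉Y , w≢x₁)) = ⊥-elim (x₂-arc-unused h bal noSwitch u∉Y e he u≡x₂ w∉Y w≢x₁)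

  potential-descends : ∀ h → Balanced h → NoSwitch h → ∀ e → h e ≡ true → potential (hd e) < potential (tl e)
  potential-descends h bal noSwitch e he = by-tail (tl e ∈? Y)
    where
    by-tail : Dec (tl e ∈ Y) → potential (hd e) < potential (tl e)
    by-tail (yes u∈Y) = descends-from-ordinary e (inj₁ u∈Y)
    by-tail (no u∉Y) = by-kind (tl e ≟ X₁ (tl e)) (tl e ≟ X₂ (tl e))
      where
      by-kind : Dec (tl e ≡ X₁ (tl e)) → Dec (tl e ≡ X₂ (tl e)) → potential (hd e) < potential (tl e)
      by-kind (yes u≡x₁) _ = descends-from-x₁ h bal noSwitch e he u∉Y u≡x₁
      by-kind (no u≢x₁) (yes u≡x₂) = descends-from-x₂ h bal noSwitch e he u∉Y u≢x₁ u≡x₂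
      by-kind (no u≢x₁) (no u≢x₂) = descends-from-ordinary e (inj₂ (u∉Y , u≢x₁ , u≢x₂))

  potential-bound : ℕ
  potential-bound = 3 * n + 3 + (n + suc K)

  potential< : ∀ z → potential z < potential-bound
  potential< z = by-kind (z ∈? Y) (z ≟ X₁ z) (z ≟ X₂ z)
    where
    small : ∀ {x} → x ≤ 3 * n + 3 → x < potential-bound
    small x≤ = ≤-<-trans x≤ (m<m+n (3 * n + 3) (≤-trans (s≤s z≤n) (m≤n+m (suc K) n)))
    3a+k≤3n+3 : ∀ {a} k → k ≤ 3 → a < n → 3 * a + k ≤ 3 * n + 3
    3a+k≤3n+3 {a} k k≤3 a<n = ≤-trans (+-monoʳ-≤ (3 * a) k≤3) (≤-trans (3a+3≤3b a<n) (m≤m+n (3 * n) 3))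
    by-kind : Dec (z ∈ Y) → Dec (z ≡ X₁ z) → Dec (z ≡ X₂ z) → potential z < potential-bound
    by-kind (yes z∈Y) _ _ = subst (_< potential-bound) (sym (potential-Y z∈Y)) (small (3a+k≤3n+3 2 (n≤1+n 2) (toℕ<n z)))
    by-kind (no z∉Y) (yes z≡x₁) _ =
      subst (_< potential-bound) (sym (potential-x₁ z∉Y z≡x₁)) (small (3a+k≤3n+3 1 (s≤s z≤n) (toℕ<n (Y₁ z))))
    by-kind (no z∉Y) (no z≢x₁) (yes z≡x₂) =
      subst (_< potential-bound) (sym (potential-x₂ z∉Y z≢x₁ z≡x₂)) (small (3a+k≤3n+3 3 ≤-refl (toℕ<n (Y₂ z))))
    by-kind (no z∉Y) (no z≢x₁) (no z≢x₂) =
      subst (_< potential-bound) (sym (potential-other z∉Y z≢x₁ z≢x₂))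
        (<-≤-trans (+-monoʳ-< (3 * n) (<-trans (rank-other< z∉Y z≢x₁ z≢x₂) (+-monoʳ-< n (n<1+n K))))
                   (+-monoˡ-≤ (n + suc K) (m≤m+n (3 * n) 3)))

  -- following used arcs backwards (a vertex with an out-arc has an in-arc)
  -- reaches vertices of arbitrarily large potential
  backward-chain : ∀ h → Balanced h → NoSwitch h → ∀ k → (∃ λ e → h e ≡ true) →
                   ∃ λ v → k ≤ potential v × 1 ≤ Out h v
  backward-chain h bal noSwitch zero (e , he) = tl e , z≤n , out-pos h _ e he refl
  backward-chain h bal noSwitch (suc k) used with backward-chain h bal noSwitch k used
  ... | v , k≤ , out =
    let (e' , he' , hd≡v) = in-witness h v (subst (1 ≤_) (sym (bal v)) out)
    in tl e' , ≤-trans (s≤s k≤) (subst (λ z → potential z < potential (tl e')) hd≡v (potential-descends h bal noSwitch e' he'))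
             , out-pos h _ e' he' refl

  no-switch⇒empty : ∀ h → Balanced h → NoSwitch h → ∀ e → h e ≡ false
  no-switch⇒empty h bal noSwitch e = not-true (h e) λ he →
    let (v , bound≤ , _) = backward-chain h bal noSwitch potential-bound (e , he)
    in <-irrefl refl (<-≤-trans (potential< v) bound≤)

  switchableAt-cong : ∀ h h' → (∀ e → h e ≡ h' e) → ∀ a → switchableAt h a ≡ switchableAt h' a
  switchableAt-cong h h' h≗h' a = cong₃ (λ x y z → IsSwitchArc a ∧ switchable x y z) (h≗h' a) (h≗h' (detour₁ a)) (h≗h' (detour₂ a))

  switch-switchable : ∀ h a → switchableAt h a ≡ true → switchableAt (switch h a) a ≡ true
  switch-switchable h a sw =
    ∧-intro isA (switchable-complete (subst₃ Switchable (sym at-a) (sym at-b) (sym at-c) (switchable-not sw-h)))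
    where
    isA : IsSwitchArc a ≡ true
    isA = proj₁ (switchableAt-sound h a sw)
    sw-h : Switchable (h a) (h (detour₁ a)) (h (detour₂ a))
    sw-h = proj₂ (switchableAt-sound h a sw)
    open SwitchArc (switch-arc a isA)
    open Toggle3 h a (detour₁ a) (detour₂ a) a≢b a≢c b≢c
    subst₃ : ∀ {A : Set} (P : A → A → A → Set) {x x' y y' z z'} → x ≡ x' → y ≡ y' → z ≡ z' → P x y z → P x' y' z'
    subst₃ P refl refl refl p = p

  switch-elsewhere : ∀ h {a} (sa : SwitchArc a) y → rep (tl y) ≢ rep (tl a) → switch h a y ≡ h y
  switch-elsewhere h {a} sa y other =
    elsewhere y (λ y≡a → other (cong (rep ∘ tl) y≡a))
                (λ y≡b → other (trans (cong (rep ∘ tl) y≡b) (cong rep tl-b)))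
                (λ y≡c → other (trans (cong (rep ∘ tl) y≡c) (trans (cong rep tl-c) rep-x₂)))
    where
    open SwitchArc sa
    open Toggle3 h a (detour₁ a) (detour₂ a) a≢b a≢c b≢c

  switchable-elsewhere : ∀ h {a} (sa : SwitchArc a) a' → SwitchArc a' → rep (tl a') ≢ rep (tl a) →
                         switchableAt (switch h a) a' ≡ switchableAt h a'
  switchable-elsewhere h {a} sa a' sa' other =
    cong₃ (λ x y z → IsSwitchArc a' ∧ switchable x y z)
      (switch-elsewhere h sa a' other)
      (switch-elsewhere h sa (detour₁ a') (λ same → other (trans (sym (cong rep (SwitchArc.tl-b sa'))) same)))
      (switch-elsewhere h sa (detour₂ a') (λ same → other (trans (sym (trans (cong rep (SwitchArc.tl-c sa')) (SwitchArc.rep-x₂ sa'))) same)))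

  first-after-switch : ∀ h a → Balanced h → first (switchableAt h) ≡ just a → first (switchableAt (switch h a)) ≡ just a
  first-after-switch h a bal first≡a = first-char (switchableAt (switch h a)) a (switch-switchable h a sw-a) before-a
    where
    sw-a : switchableAt h a ≡ true
    sw-a = first-just (switchableAt h) first≡a
    sound : IsSwitchArc a ≡ true × Switchable (h a) (h (detour₁ a)) (h (detour₂ a))
    sound = switchableAt-sound h a sw-a
    sa : SwitchArc a
    sa = switch-arc a (proj₁ sound)
    bal' : Balanced (switch h a)
    bal' = switch-balanced h a bal sa (proj₂ sound)
    before-a : ∀ j → toℕ j < toℕ a → switchableAt (switch h a) j ≡ false
    before-a j j<a = by-kind (IsSwitchArc j) refl
      where
      by-component : IsSwitchArc j ≡ true → Dec (rep (tl j) ≡ rep (tl a)) → switchableAt (switch h a) j ≡ true → ⊥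
      -- in the component of a, a stays the only switchable arc
      by-component _ (yes same) sw-j =
        <-irrefl (cong toℕ (switchable-unique (switch h a) j a bal' sw-j (switch-switchable h a sw-a) same)) j<a
      -- elsewhere nothing changed, and j comes before the first switchable arc
      by-component isA-j (no other) sw-j =
        <-irrefl refl (<-≤-trans j<a (first-min (switchableAt h) j first≡a
          (trans (sym (switchable-elsewhere h sa j (switch-arc j isA-j) other)) sw-j)))
      by-kind : ∀ b → IsSwitchArc j ≡ b → switchableAt (switch h a) j ≡ false
      by-kind false isA-j =
        cong (λ i → i ∧ switchable (switch h a j) (switch h a (detour₁ j)) (switch h a (detour₂ j))) isA-j
      by-kind true isA-j = not-true _ (by-component isA-j (rep (tl j) ≟ rep (tl a)))

  switch-first : (Fin m → Bool) → Maybe (Fin m) → Fin m → Bool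
  switch-first h nothing  = h
  switch-first h (just a) = switch h a

  ι : (Fin m → Bool) → Fin m → Bool
  ι h = switch-first h (first (switchableAt h))

  ι-nothing : ∀ h → first (switchableAt h) ≡ nothing → ∀ x → ι h x ≡ h x
  ι-nothing h eq x = cong (λ mb → switch-first h mb x) eq

  ι-just : ∀ h a → first (switchableAt h) ≡ just a → ∀ x → ι h x ≡ switch h a x
  ι-just h a eq x = cong (λ mb → switch-first h mb x) eq

  ι-cong : ∀ h h' → (∀ e → h e ≡ h' e) → ∀ x → ι h x ≡ ι h' x
  ι-cong h h' h≗h' x =
    trans (same-choice (first (switchableAt h)))
          (cong (λ mb → switch-first h' mb x) (first-ext _ _ (switchableAt-cong h h' h≗h')))
    where
    same-choice : ∀ mb → switch-first h mb x ≡ switch-first h' mb x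
    same-choice nothing  = h≗h' x
    same-choice (just a) = toggle3-cong a (detour₁ a) (detour₂ a) h≗h' x

  ι-balanced : ∀ h → Balanced h → Balanced (ι h)
  ι-balanced h bal with first-cases (switchableAt h)
  ... | inj₁ none = Balanced-ext h (ι h) (λ x → sym (ι-nothing h none x)) bal
  ... | inj₂ (a , first≡a) =
    Balanced-ext (switch h a) (ι h) (λ x → sym (ι-just h a first≡a x)) (switch-balanced h a bal (switch-arc a (proj₁ sound)) (proj₂ sound))
    where
    sound : IsSwitchArc a ≡ true × Switchable (h a) (h (detour₁ a)) (h (detour₂ a))
    sound = switchableAt-sound h a (first-just (switchableAt h) first≡a)

  ι-involutive : ∀ h → Balanced h → ∀ x → ι (ι h) x ≡ h x
  ι-involutive h bal x with first-cases (switchableAt h)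
  ... | inj₁ none = trans (ι-cong (ι h) h (ι-nothing h none) x) (ι-nothing h none x)
  ... | inj₂ (a , first≡a) =
    trans (ι-cong (ι h) (switch h a) (ι-just h a first≡a) x)
      (trans (ι-just (switch h a) a (first-after-switch h a bal first≡a) x)
        (toggle3-involutive h a (detour₁ a) (detour₂ a) a≢b a≢c b≢c x))
    where open SwitchArc (switch-arc a (proj₁ (switchableAt-sound h a (first-just (switchableAt h) first≡a))))

  NonEmpty : (Fin m → Bool) → Set
  NonEmpty h = ∃ λ e → h e ≡ true

  nonempty⇒switchable : ∀ h → Balanced h → NonEmpty h → ∃ λ a → first (switchableAt h) ≡ just a
  nonempty⇒switchable h bal (e , he) with first-cases (switchableAt h)
  ... | inj₁ none = ⊥-elim (true≢false (trans (sym he) (no-switch⇒empty h bal (first-nothing (switchableAt h) none) e)))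
  ... | inj₂ found = found

  ι-size : ∀ h → Balanced h → NonEmpty h → OffByOne (count h) (count (ι h))
  ι-size h bal ne with nonempty⇒switchable h bal ne
  ... | a , first≡a =
    switch-size (count (ι h)) (count h) (proj₂ sound)
      (trans (cong (_+ used) ι-count) (trans (count-toggle3 (λ _ → true)) (cong (_+ unused) h-count)))
    where
    sound : IsSwitchArc a ≡ true × Switchable (h a) (h (detour₁ a)) (h (detour₂ a))
    sound = switchableAt-sound h a (first-just (switchableAt h) first≡a)
    open SwitchArc (switch-arc a (proj₁ sound))
    open Toggle3 h a (detour₁ a) (detour₂ a) a≢b a≢c b≢c
    used unused : ℕ
    used   = ind (h a ∧ true) + ind (h (detour₁ a) ∧ true) + ind (h (detour₂ a) ∧ true)
    unused = ind (not (h a) ∧ true) + ind (not (h (detour₁ a)) ∧ true) + ind (not (h (detour₂ a)) ∧ true)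
    ι-count : count (ι h) ≡ count (λ x → switch h a x ∧ true)
    ι-count = count-ext _ _ (λ x → trans (ι-just h a first≡a x) (sym (∧-identityʳ _)))
    h-count : count (λ x → h x ∧ true) ≡ count h
    h-count = count-ext _ _ (λ x → ∧-identityʳ (h x))

  ι-nonempty : ∀ h → Balanced h → NonEmpty h → NonEmpty (ι h)
  ι-nonempty h bal ne with nonempty⇒switchable h bal ne
  ... | a , first≡a = witness (switchableAt-sound (switch h a) a (switch-switchable h a (first-just (switchableAt h) first≡a)))
    where
    witness : IsSwitchArc a ≡ true × Switchable (switch h a a) (switch h a (detour₁ a)) (switch h a (detour₂ a)) → NonEmpty (ι h)
    witness (_ , inj₁ (ha , _ , _)) = a , trans (ι-just h a first≡a a) ha
    witness (_ , inj₂ (_ , hb , _)) = detour₁ a , trans (ι-just h a first≡a (detour₁ a)) hb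

  eulerian⇒balanced : ∀ H → Eulerian G D H → Balanced (lookup H)
  eulerian⇒balanced H eul v = trans (sym (in≡ v)) (trans (eul v) (out≡ v))
    where
    in≡ : ∀ v → indegSub G D H v ≡ In (lookup H) v
    in≡ v = trans (countFin≡count G (λ e → (e ∈? H) ×-dec (hd e ≟ v)))
                  (count-ext _ _ (λ e → cong (_∧ does (hd e ≟ v)) (∈?-lookup e H)))
    out≡ : ∀ v → outdegSub G D H v ≡ Out (lookup H) v
    out≡ v = trans (countFin≡count G (λ e → (e ∈? H) ×-dec (tl e ≟ v)))
                   (count-ext _ _ (λ e → cong (_∧ does (tl e ≟ v)) (∈?-lookup e H)))

  balanced⇒eulerian : ∀ H → Balanced (lookup H) → Eulerian G D H
  balanced⇒eulerian H bal v = trans (in≡ v) (trans (bal v) (sym (out≡ v)))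
    where
    in≡ : ∀ v → indegSub G D H v ≡ In (lookup H) v
    in≡ v = trans (countFin≡count G (λ e → (e ∈? H) ×-dec (hd e ≟ v)))
                  (count-ext _ _ (λ e → cong (_∧ does (hd e ≟ v)) (∈?-lookup e H)))
    out≡ : ∀ v → outdegSub G D H v ≡ Out (lookup H) v
    out≡ v = trans (countFin≡count G (λ e → (e ∈? H) ×-dec (tl e ≟ v)))
                   (count-ext _ _ (λ e → cong (_∧ does (tl e ≟ v)) (∈?-lookup e H)))

  Even Odd Nonempty : Subset m → Set
  Even H = Eulerian G D H × ∣ H ∣ % 2 ≡ 0
  Odd  H = Eulerian G D H × ∣ H ∣ % 2 ≡ 1
  Nonempty H = NonEmpty (lookup H)

  even? : ∀ H → Dec (Even H)
  even? H = eulerian? G D H ×-dec (∣ H ∣ % 2 ≟ℕ 0)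

  odd? : ∀ H → Dec (Odd H)
  odd? H = eulerian? G D H ×-dec (∣ H ∣ % 2 ≟ℕ 1)

  nonempty? : ∀ H → Dec (Nonempty H)
  nonempty? H = any? (λ e → bool? (lookup H e))

  ιₛ : Subset m → Subset m
  ιₛ H = tabulate (ι (lookup H))

  lookup-ιₛ : ∀ H x → lookup (ιₛ H) x ≡ ι (lookup H) x
  lookup-ιₛ H = lookup∘tabulate (ι (lookup H))

  ιₛ-involutive : ∀ H → Eulerian G D H → ιₛ (ιₛ H) ≡ H
  ιₛ-involutive H eul =
    trans (tabulate-cong (λ x → trans (ι-cong (lookup (ιₛ H)) (ι (lookup H)) (lookup-ιₛ H) x)
                                      (ι-involutive (lookup H) (eulerian⇒balanced H eul) x)))
          (tabulate∘lookup H)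

  ιₛ-eulerian : ∀ H → Eulerian G D H → Eulerian G D (ιₛ H)
  ιₛ-eulerian H eul = balanced⇒eulerian (ιₛ H)
    (Balanced-ext _ _ (λ x → sym (lookup-ιₛ H x)) (ι-balanced (lookup H) (eulerian⇒balanced H eul)))

  ιₛ-size : ∀ H → Eulerian G D H → Nonempty H → OffByOne ∣ H ∣ ∣ ιₛ H ∣
  ιₛ-size H eul ne = subst₂ OffByOne (sym (∣∣≡count H)) (sym (trans (∣∣≡count (ιₛ H)) (count-ext _ _ (lookup-ιₛ H))))
                       (ι-size (lookup H) (eulerian⇒balanced H eul) ne)

  odd-nonempty : ∀ H → ∣ H ∣ % 2 ≡ 1 → Nonempty H
  odd-nonempty H odd with ∣ H ∣ in size
  ... | suc _ = count-witness (lookup H) (subst (1 ≤_) (trans (sym size) (∣∣≡count H)) (s≤s z≤n))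

  odd⇒even : ∀ H → Odd H → Even (ιₛ H) × Nonempty (ιₛ H)
  odd⇒even H (eul , odd) =
    (ιₛ-eulerian H eul , odd→even (ιₛ-size H eul ne) odd) ,
    (let (e , he) = ι-nonempty (lookup H) (eulerian⇒balanced H eul) ne in e , trans (lookup-ιₛ H e) he)
    where ne = odd-nonempty H odd

  even⇒odd : ∀ H → Even H × Nonempty H → Odd (ιₛ H)
  even⇒odd H ((eul , even) , ne) = ιₛ-eulerian H eul , even→odd (ιₛ-size H eul ne) even

  ∅ : Subset m
  ∅ = replicate m false

  only-∅ : ∀ H → Even H × ¬ Nonempty H → H ≡ ∅
  only-∅ H (_ , empty) =
    trans (sym (tabulate∘lookup H))
      (trans (tabulate-cong (λ x → trans (not-true (lookup H x) (λ p → empty (x , p))) (sym (lookup-replicate {n = m} x false))))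
             (tabulate∘lookup ∅))

  ∅-even : Even ∅ × ¬ Nonempty ∅
  ∅-even =
    (balanced⇒eulerian ∅ (λ v → trans (count-zero _ (λ e → cong (_∧ does (hd e ≟ v)) (lookup-replicate {n = m} e false)))
                                       (sym (count-zero _ (λ e → cong (_∧ does (tl e ≟ v)) (lookup-replicate {n = m} e false))))) ,
     cong (_% 2) (trans (∣∣≡count ∅) (count-zero _ (λ x → lookup-replicate {n = m} x false)))) ,
    λ (e , p) → true≢false (trans (sym p) (lookup-replicate {n = m} e false))

  -- |even| = |nonempty even| + |empty even| = |odd| + 1
  EE≡EO+1 : EE G D ≡ EO G D + 1
  EE≡EO+1 =
    trans (length-filter-split even? nonempty? L)
          (cong₂ _+_ (sym (length-filter-involution L unique complete odd? (λ H → even? H ×-dec nonempty? H) ιₛ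
                             odd⇒even even⇒odd (λ H odd → ιₛ-involutive H (proj₁ odd)) (λ H q → ιₛ-involutive H (proj₁ (proj₁ q)))))
                     (length-filter-singleton (λ H → even? H ×-dec ¬? (nonempty? H)) L ∅ unique (complete ∅) only-∅ ∅-even))
    where
    L : List (Subset m)
    L = allSubsets m
    unique : Unique L
    unique = allSubsets-unique m
    complete : ∀ H → H ∈ₗ L
    complete = allSubsets-complete m

lemma3p1 : (G : Multigraph) (f : Fin (Multigraph.n G) → ℕ)
           (F : Subset (Multigraph.m G)) (Y : Subset (Multigraph.n G)) →
           Hyp1 G Y → Hyp2 G f Y → Hyp3 G f F Y → Hyp4 G F Y →
           _-AT G f
lemma3p1 G f F Y hyp1 hyp2 hyp3 hyp4 = D , outdeg-bound , EE≢EO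
  where
  open Lemma3-1 G f F Y hyp1 hyp2 hyp3 hyp4
  EE≢EO : EE G D ≢ EO G D
  EE≢EO EE≡EO = 1+n≢n (trans (+-comm 1 (EO G D)) (trans (sym EE≡EO+1) EE≡EO))
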